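{- Let $n \geq 4$ be an even integer and let $\widetilde{L}$ be the special Laplacian of the wheel graph $W_n$. Then every cofactor of $\widetilde{L}$ is equal to $2^{n-3}$.
   Context: For $c=(c_1,\dotsc,c_m)$, $\mathrm{Circ}(c)$ denotes the $m\times m$ circulant matrix whose $(i,j)$ entry is $c_{((j-i) \bmod m)+1}$. Special Laplacian: for $n\ge4$ even and $k\in\{1,\dotsc,\frac n2-1\}$, let $c^k\in\mathbb{R}^{n-1}$ have $c^k_j=1$ if $j=k+1$ or $j=n-k$ and $c^k_j=0$ otherwise, and let $C_k=\mathrm{Circ}(c^k)$ (of order $n-1$). Then \[\widetilde{L} := \frac{n-1}{2} I - \frac12\begin{bmatrix}0 & \mathbf{1}'\\ \mathbf{1} & 0\end{bmatrix} + \sum_{k=1}^{\frac n2 -1} (-1)^k \frac{(n-1)-2k}{2}\begin{bmatrix}0&0\\0&C_k\end{bmatrix},\] an $n\times n$ matrix, where $\mathbf{1}$ is the all-ones vector of length $n-1$. The $(i,j)$ cofactor of an $n\times n$ matrix $A$ is $(-1)^{i+j}$ times the determinant of the submatrix obtained by deleting row $i$ and column $j$. -}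

module Defs where

open import Data.Nat as ℕ using (ℕ; zero; suc; _∸_; _≡ᵇ_)
open import Data.Nat.DivMod using (_mod_)
open import Data.Fin using (Fin; zero; suc; toℕ; punchIn)
open import Data.Bool using (Bool; true; false; if_then_else_; _∨_)
open import Data.List using (List; map; foldr; upTo)
open import Data.Integer using (+_)
open import Data.Rational using (ℚ; 0ℚ; 1ℚ; _+_; _*_; -_; _/_)

-- square matrices over ℚ, indices 0-based (row/column 0 = paper's row/column 1)
Matrix : ℕ → Set
Matrix n = Fin n → Fin n → ℚ

Σᶠ : ∀ {n} → (Fin n → ℚ) → ℚ
Σᶠ {zero}  f = 0ℚ
Σᶠ {suc n} f = f zero + Σᶠ (λ i → f (suc i))

sgn : ℕ → ℚ
sgn zero    = 1ℚ
sgn (suc k) = - sgn k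

minor : ∀ {m} → Matrix (suc m) → Fin (suc m) → Fin (suc m) → Matrix m
minor A i j r c = A (punchIn i r) (punchIn j c)

det : ∀ {n} → Matrix n → ℚ
det {zero}  A = 1ℚ
det {suc m} A = Σᶠ (λ j → sgn (toℕ j) * (A zero j * det (minor A zero j)))

cofactor : ∀ {n} → Matrix n → Fin n → Fin n → ℚ
cofactor {suc m} A i j = sgn (toℕ i ℕ.+ toℕ j) * det (minor A i j)

-- Circ(c): (i,j) entry is c_{((j-i) mod m)+1}; with 0-based c this is c ((j-i) mod m)
Circ : ∀ {m} → (Fin m → ℚ) → Matrix m
Circ {suc m} c i j = c ((toℕ j ℕ.+ suc m ∸ toℕ i) mod suc m)

-- c^k ∈ ℚ^(n-1): (1-based) c^k_j = 1 iff j = k+1 or j = n-k.  Here index t : Fin (n-1) is j = t+1.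
cvec : (n k : ℕ) → Fin (n ∸ 1) → ℚ
cvec n k t = if (suc (toℕ t) ≡ᵇ suc k) ∨ (suc (toℕ t) ≡ᵇ n ∸ k) then 1ℚ else 0ℚ

C : (n k : ℕ) → Matrix (n ∸ 1)
C n k = Circ (cvec n k)

half : ℕ → ℚ
half q = (+ q) / 2

sumℚ : List ℚ → ℚ
sumℚ = foldr _+_ 0ℚ

specialLaplacian : (n : ℕ) → Matrix n
specialLaplacian zero ()
specialLaplacian (suc m) i j = idPart i j + (onesPart i j + circPart i j)
  where
  n = suc m
  idPart : Fin n → Fin n → ℚ
  idPart i j = if toℕ i ≡ᵇ toℕ j then half (n ∸ 1) else 0ℚ
  onesPart : Fin n → Fin n → ℚ
  onesPart zero    zero    = 0ℚ
  onesPart zero    (suc _) = - half 1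
  onesPart (suc _) zero    = - half 1
  onesPart (suc _) (suc _) = 0ℚ
  -- Σ_{k=1}^{n/2-1} (-1)^k ((n-1)-2k)/2 [[0,0],[0,C_k]]   (note n ∸ 1 = m definitionally)
  circPart : Fin n → Fin n → ℚ
  circPart zero    _       = 0ℚ
  circPart (suc _) zero    = 0ℚ
  circPart (suc r) (suc c) =
    sumℚ (map (λ k → sgn k * (half ((n ∸ 1) ∸ 2 ℕ.* k) * C n k r c))
              (map suc (upTo (n ℕ./ 2 ∸ 1))))

-- Write n = 2p + 2 and m = n − 1. Since φ(m − d) = φ(d) for φ(d) = (−1)^d (m − 2d)/2, the circulant
-- part of L̃ makes its lower-right m × m block the Toeplitz matrix Φ = (φ |r − c|). Every row and
-- column of L̃ sums to zero, so when the deleted column moves one step to the right, the column that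
-- reappears in the minor is minus the sum of the others: the minor changes sign, which the factor
-- (−1)^(i+j) compensates. Hence every cofactor equals det Φ. Adding to each column of Φ its right
-- neighbour turns the first 2p columns into alternating ±1 vectors; doing it once more turns the first
-- n − 3 columns into 2e₂, …, 2e_{n−2}. Expanding along them leaves (−2)^(n−3) times a 2 × 2 determinant
-- equal to −1, and n − 3 is odd.

module Submission where

open import Defs
open import Algebra.Bundles using (CommutativeRing)
open import Data.Bool using (true; false; if_then_else_; _∨_)
open import Data.Bool.Properties using (∨-zeroʳ)
open import Data.Empty using (⊥-elim)
open import Data.Fin as Fin using (Fin; zero; suc; toℕ; punchIn; punchOut; inject₁)
open import Data.Fin.Induction using (<-weakInduction)
open import Data.Fin.Permutation.Components using (transpose)
import Data.Fin.Properties as Fin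
import Data.Integer as ℤ
open import Data.Integer.Tactic.RingSolver using () renaming (solve-∀ to ℤ-solve-∀)
import Data.List as List
import Data.List.Properties as List
open import Data.Nat as ℕ using (ℕ; zero; suc; _∸_; _^_; _≤_; _<_; z≤n; s≤s; _≡ᵇ_; ∣_-_∣)
open import Data.Nat.DivMod using (_mod_; _%_; [m+n]%n≡m%n; m<n⇒m%n≡m; m*n/n≡m)
open import Data.Nat.Divisibility using (_∣_; divides)
import Data.Nat.Properties as ℕ
open import Data.Nat.Tactic.RingSolver using () renaming (solve-∀ to ℕ-solve-∀)
open import Data.Product using (_×_; _,_; ∃-syntax)
open import Data.Rational using (ℚ; _/_; 0ℚ; 1ℚ; ½; _+_; _-_; _*_; -_; fromℚᵘ)
import Data.Rational.Properties as ℚ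
open import Data.Rational.Solver using (module +-*-Solver)
open import Data.Rational.Unnormalised as ℚᵘ using (mkℚᵘ)
import Data.Rational.Unnormalised.Properties as ℚᵘ
open import Data.Sum using (_⊎_; inj₁; inj₂)
open import Data.Vec.Functional using (updateAt)
open import Data.Vec.Functional.Properties using (updateAt-updates; updateAt-minimal)
open import Function using (_∘_)
open import Relation.Binary.Definitions using (tri<; tri≈; tri>)
open import Relation.Binary.PropositionalEquality
open import Relation.Nullary using (¬_)
open import Relation.Nullary.Decidable using (Dec; does; yes; no; dec-true; dec-false)

open import Algebra.Properties.Group ℚ.+-0-group using (inverseˡ-unique; ⁻¹-involutive)
open import Algebra.Properties.Semiring.Sum (CommutativeRing.semiring ℚ.+-*-commutativeRing)

open +-*-Solver

Σᶠ≡sum : ∀ {n} (f : Fin n → ℚ) → Σᶠ f ≡ sum f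
Σᶠ≡sum {zero}  f = refl
Σᶠ≡sum {suc n} f = cong (f zero +_) (Σᶠ≡sum (f ∘ suc))

sum-zero : ∀ {n} {f : Fin n → ℚ} → (∀ i → f i ≡ 0ℚ) → sum f ≡ 0ℚ
sum-zero {n} f≡0 = trans (sum-cong-≗ f≡0) (sum-replicate-zero n)

sum-single : ∀ {n} (f : Fin n → ℚ) (k : Fin n) → (∀ i → i ≢ k → f i ≡ 0ℚ) → sum f ≡ f k
sum-single {suc n} f zero    f≡0 =
  trans (cong (f zero +_) (sum-zero (λ i → f≡0 (suc i) (λ ())))) (ℚ.+-identityʳ (f zero))
sum-single {suc n} f (suc k) f≡0 =
  trans (cong₂ _+_ (f≡0 zero (λ ())) (sum-single (f ∘ suc) k (λ i i≢k → f≡0 (suc i) (i≢k ∘ Fin.suc-injective))))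
        (ℚ.+-identityˡ (f (suc k)))

sum-neg : ∀ {n} (f : Fin n → ℚ) → sum (λ i → - f i) ≡ - sum f
sum-neg {zero}  f = refl
sum-neg {suc n} f = trans (cong (- f zero +_) (sum-neg (f ∘ suc))) (sym (ℚ.neg-distrib-+ (f zero) (sum (f ∘ suc))))

sum-cong-except-adjacent : ∀ {n} (f g : Fin n → ℚ) (a b : Fin n) → toℕ b ≡ suc (toℕ a) →
  (∀ j → j ≢ a → j ≢ b → f j ≡ g j) → f a + f b ≡ g a + g b → sum f ≡ sum g
sum-cong-except-adjacent {suc (suc n)} f g zero (suc zero) _ f≡g pair = begin
  f zero + (f (suc zero) + rest f)  ≡⟨ ℚ.+-assoc (f zero) _ _ ⟨
  (f zero + f (suc zero)) + rest f  ≡⟨ cong₂ _+_ pair (sum-cong-≗ (λ i → f≡g (suc (suc i)) (λ ()) (λ ()))) ⟩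
  (g zero + g (suc zero)) + rest g  ≡⟨ ℚ.+-assoc (g zero) _ _ ⟩
  g zero + (g (suc zero) + rest g)  ∎
  where
  open ≡-Reasoning
  rest : (Fin (suc (suc n)) → ℚ) → ℚ
  rest h = sum (λ i → h (suc (suc i)))
sum-cong-except-adjacent {suc n} f g (suc a) (suc b) b≡a+1 f≡g pair =
  cong₂ _+_ (f≡g zero (λ ()) (λ ()))
    (sum-cong-except-adjacent (f ∘ suc) (g ∘ suc) a b (ℕ.suc-injective b≡a+1)
      (λ j j≢a j≢b → f≡g (suc j) (j≢a ∘ Fin.suc-injective) (j≢b ∘ Fin.suc-injective)) pair)

sumTo : ℕ → (ℕ → ℚ) → ℚ
sumTo N f = sum {N} (λ k → f (toℕ k))

sumTo-cong : ∀ N {f g : ℕ → ℚ} → (∀ k → k < N → f k ≡ g k) → sumTo N f ≡ sumTo N g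
sumTo-cong N f≡g = sum-cong-≗ (λ k → f≡g (toℕ k) (Fin.toℕ<n k))

sumTo-zero : ∀ N {f : ℕ → ℚ} → (∀ k → k < N → f k ≡ 0ℚ) → sumTo N f ≡ 0ℚ
sumTo-zero N f≡0 = trans (sumTo-cong N f≡0) (sum-replicate-zero N)

sumTo-single : ∀ N (f : ℕ → ℚ) k → k < N → (∀ j → j < N → j ≢ k → f j ≡ 0ℚ) → sumTo N f ≡ f k
sumTo-single N f k k<N f≡0 = trans (sum-single (f ∘ toℕ) (Fin.fromℕ< k<N) other) (cong f (Fin.toℕ-fromℕ< k<N))
  where
  other : ∀ i → i ≢ Fin.fromℕ< k<N → f (toℕ i) ≡ 0ℚ
  other i i≢k = f≡0 (toℕ i) (Fin.toℕ<n i) (λ e → i≢k (Fin.toℕ-injective (trans e (sym (Fin.toℕ-fromℕ< k<N)))))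

sumTo-snoc : ∀ N (f : ℕ → ℚ) → sumTo (suc N) f ≡ sumTo N f + f N
sumTo-snoc zero    f = trans (ℚ.+-identityʳ (f 0)) (sym (ℚ.+-identityˡ (f 0)))
sumTo-snoc (suc N) f = trans (cong (f 0 +_) (sumTo-snoc N (f ∘ suc))) (sym (ℚ.+-assoc (f 0) (sumTo N (f ∘ suc)) (f (suc N))))

sumℚ-applyUpTo : ∀ (F : ℕ → ℚ) (g : ℕ → ℕ) N → sumℚ (List.map F (List.applyUpTo g N)) ≡ sumTo N (F ∘ g)
sumℚ-applyUpTo F g zero    = refl
sumℚ-applyUpTo F g (suc N) = cong (F (g 0) +_) (sumℚ-applyUpTo F (g ∘ suc) N)

∸-suc : ∀ a b → b < a → a ∸ b ≡ suc (a ∸ suc b)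
∸-suc a b b<a = ℕ.+-∸-assoc 1 b<a

fromℕ : ℕ → ℚ
fromℕ zero    = 0ℚ
fromℕ (suc k) = 1ℚ + fromℕ k

fromℕ-+ : ∀ a b → fromℕ (a ℕ.+ b) ≡ fromℕ a + fromℕ b
fromℕ-+ zero    b = sym (ℚ.+-identityˡ (fromℕ b))
fromℕ-+ (suc a) b = trans (cong (1ℚ +_) (fromℕ-+ a b)) (sym (ℚ.+-assoc 1ℚ (fromℕ a) (fromℕ b)))

sum-const : ∀ N (a : ℚ) → sum {N} (λ _ → a) ≡ fromℕ N * a
sum-const zero    a = sym (ℚ.*-zeroˡ a)
sum-const (suc N) a = trans (cong (a +_) (sum-const N a)) (collect a (fromℕ N))
  where
  collect : ∀ a k → a + k * a ≡ (1ℚ + k) * a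
  collect = solve 2 (λ a k → a :+ k :* a := (con 1ℚ :+ k) :* a) refl

fromℕ-∸ : ∀ a b → b ≤ a → fromℕ (a ∸ b) ≡ fromℕ a - fromℕ b
fromℕ-∸ a b b≤a = begin
  fromℕ (a ∸ b)                          ≡⟨ shift (fromℕ (a ∸ b)) (fromℕ b) ⟩
  (fromℕ (a ∸ b) + fromℕ b) - fromℕ b    ≡⟨ cong (_- fromℕ b) (trans (sym (fromℕ-+ (a ∸ b) b)) (cong fromℕ (ℕ.m∸n+n≡m b≤a))) ⟩
  fromℕ a - fromℕ b                      ∎
  where
  open ≡-Reasoning
  shift : ∀ x y → x ≡ (x + y) - y
  shift = solve 2 (λ x y → x := (x :+ y) :+ :- y) refl

fromℕ-2^ : ∀ k → fromℕ (2 ^ suc k) ≡ fromℕ (2 ^ k) + fromℕ (2 ^ k)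
fromℕ-2^ k = trans (fromℕ-+ (2 ^ k) (2 ^ k ℕ.+ 0)) (cong (λ x → fromℕ (2 ^ k) + fromℕ x) (ℕ.+-identityʳ (2 ^ k)))

fromℚᵘ-homo-+ : ∀ x y → fromℚᵘ (x ℚᵘ.+ y) ≡ fromℚᵘ x + fromℚᵘ y
fromℚᵘ-homo-+ x y = ℚ.toℚᵘ-injective (ℚᵘ.≃-trans (ℚ.toℚᵘ-fromℚᵘ (x ℚᵘ.+ y))
  (ℚᵘ.≃-sym (ℚᵘ.≃-trans (ℚ.toℚᵘ-homo-+ (fromℚᵘ x) (fromℚᵘ y))
                        (ℚᵘ.+-cong (ℚ.toℚᵘ-fromℚᵘ x) (ℚ.toℚᵘ-fromℚᵘ y)))))

/-suc : ∀ k d → (ℤ.+ suc k) / suc d ≡ (ℤ.+ 1) / suc d + (ℤ.+ k) / suc d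
/-suc k d =
  trans (ℚ.fromℚᵘ-cong {mkℚᵘ (ℤ.+ suc k) d} {mkℚᵘ (ℤ.+ 1) d ℚᵘ.+ mkℚᵘ (ℤ.+ k) d} (ℚᵘ.*≡* (cross-multiply (ℤ.+ k) (ℤ.+ suc d))))
        (fromℚᵘ-homo-+ (mkℚᵘ (ℤ.+ 1) d) (mkℚᵘ (ℤ.+ k) d))
  where
  cross-multiply : ∀ K D → (ℤ.1ℤ ℤ.+ K) ℤ.* (D ℤ.* D) ≡ (ℤ.1ℤ ℤ.* D ℤ.+ K ℤ.* D) ℤ.* D
  cross-multiply = ℤ-solve-∀

/-fromℕ : ∀ k d → (ℤ.+ k) / suc d ≡ fromℕ k * ((ℤ.+ 1) / suc d)
/-fromℕ zero    d = trans (ℚ.0/n≡0 (suc d)) (sym (ℚ.*-zeroˡ ((ℤ.+ 1) / suc d)))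
/-fromℕ (suc k) d = begin
  (ℤ.+ suc k) / suc d                               ≡⟨ /-suc k d ⟩
  (ℤ.+ 1) / suc d + (ℤ.+ k) / suc d                   ≡⟨ cong ((ℤ.+ 1) / suc d +_) (/-fromℕ k d) ⟩
  (ℤ.+ 1) / suc d + fromℕ k * ((ℤ.+ 1) / suc d)       ≡⟨ collect ((ℤ.+ 1) / suc d) (fromℕ k) ⟩
  (1ℚ + fromℕ k) * ((ℤ.+ 1) / suc d)                ∎
  where
  open ≡-Reasoning
  collect : ∀ x a → x + a * x ≡ (1ℚ + a) * x
  collect = solve 2 (λ x a → x :+ a :* x := (con 1ℚ :+ a) :* x) refl

half≡fromℕ*½ : ∀ k → half k ≡ fromℕ k * ½
half≡fromℕ*½ k = /-fromℕ k 1

/1≡fromℕ : ∀ k → (ℤ.+ k) / 1 ≡ fromℕ k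
/1≡fromℕ k = trans (/-fromℕ k 0) (ℚ.*-identityʳ (fromℕ k))

sgn-+ : ∀ a b → sgn (a ℕ.+ b) ≡ sgn a * sgn b
sgn-+ zero    b = sym (ℚ.*-identityˡ (sgn b))
sgn-+ (suc a) b = trans (cong -_ (sgn-+ a b)) (ℚ.neg-distribˡ-* (sgn a) (sgn b))

sgn-double : ∀ a → sgn (a ℕ.+ a) ≡ 1ℚ
sgn-double zero    = refl
sgn-double (suc a) = trans (cong sgn (ℕ.+-suc (suc a) a)) (trans (⁻¹-involutive (sgn (a ℕ.+ a))) (sgn-double a))

if-yes : ∀ {P : Set} (P? : Dec P) (a b : ℚ) → P → (if does P? then a else b) ≡ a
if-yes P? a b p = cong (if_then a else b) (dec-true P? p)

if-no : ∀ {P : Set} (P? : Dec P) (a b : ℚ) → ¬ P → (if does P? then a else b) ≡ b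
if-no P? a b ¬p = cong (if_then a else b) (dec-false P? ¬p)

-- Determinants

firstRowTerm : ∀ {m} → Matrix (suc m) → Fin (suc m) → ℚ
firstRowTerm A j = sgn (toℕ j) * (A zero j * det (minor A zero j))

firstColumnTerm : ∀ {m} → Matrix (suc m) → Fin (suc m) → ℚ
firstColumnTerm A i = sgn (toℕ i) * (A i zero * det (minor A i zero))

det-expand : ∀ {m} (A : Matrix (suc m)) → det A ≡ sum (firstRowTerm A)
det-expand A = Σᶠ≡sum (firstRowTerm A)

det-cong : ∀ {n} {A B : Matrix n} → (∀ r c → A r c ≡ B r c) → det A ≡ det B
det-cong {zero}          A≡B = refl
det-cong {suc n} {A} {B} A≡B = begin
  det A                 ≡⟨ det-expand A ⟩
  sum (firstRowTerm A)  ≡⟨ sum-cong-≗ term≡ ⟩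
  sum (firstRowTerm B)  ≡⟨ det-expand B ⟨
  det B                 ∎
  where
  open ≡-Reasoning
  term≡ : ∀ j → firstRowTerm A j ≡ firstRowTerm B j
  term≡ j = cong₂ (λ x y → sgn (toℕ j) * (x * y)) (A≡B zero j) (det-cong (λ r c → A≡B (suc r) (punchIn j c)))

det-expand-column : ∀ {m} (A : Matrix (suc m)) → det A ≡ sum (firstColumnTerm A)
det-expand-column {zero}  A = refl
det-expand-column {suc m} A = trans (det-expand A) (cong (firstRowTerm A zero +_) (begin
  sum (λ j → sgn (suc (toℕ j)) * (a j * det (minor A zero (suc j))))
    ≡⟨ sum-cong-≗ (λ j → cong (λ x → sgn (suc (toℕ j)) * (a j * x)) (det-expand-column (minor A zero (suc j)))) ⟩
  sum (λ j → sgn (suc (toℕ j)) * (a j * sum (λ i → sgn (toℕ i) * (b i * D i j))))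
    ≡⟨ sum-cong-≗ (λ j → pull (sgn (suc (toℕ j))) (a j) (λ i → sgn (toℕ i) * (b i * D i j))) ⟩
  sum (λ j → sum (λ i → sgn (suc (toℕ j)) * (a j * (sgn (toℕ i) * (b i * D i j)))))
    ≡⟨ ∑-comm (λ j i → sgn (suc (toℕ j)) * (a j * (sgn (toℕ i) * (b i * D i j)))) ⟩
  sum (λ i → sum (λ j → sgn (suc (toℕ j)) * (a j * (sgn (toℕ i) * (b i * D i j)))))
    ≡⟨ sum-cong-≗ (λ i → sum-cong-≗ (λ j → exchange (sgn (toℕ j)) (a j) (sgn (toℕ i)) (b i) (D i j))) ⟩
  sum (λ i → sum (λ j → sgn (suc (toℕ i)) * (b i * (sgn (toℕ j) * (a j * D i j)))))
    ≡⟨ sum-cong-≗ (λ i → trans (sym (pull (sgn (suc (toℕ i))) (b i) (λ j → sgn (toℕ j) * (a j * D i j))))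
                               (cong (λ x → sgn (suc (toℕ i)) * (b i * x)) (sym (det-expand (minor A (suc i) zero))))) ⟩
  sum (λ i → sgn (suc (toℕ i)) * (b i * det (minor A (suc i) zero)))
    ∎))
  where
  open ≡-Reasoning
  a b : Fin (suc m) → ℚ
  a j = A zero (suc j)
  b i = A (suc i) zero
  D : Fin (suc m) → Fin (suc m) → ℚ
  D i j = det (minor (minor A (suc i) zero) zero j)
  pull : ∀ s x (f : Fin (suc m) → ℚ) → s * (x * sum f) ≡ sum (λ i → s * (x * f i))
  pull s x f = trans (cong (s *_) (*-distribˡ-sum x f)) (*-distribˡ-sum s (λ i → x * f i))
  exchange : ∀ sj aj si bi d → (- sj) * (aj * (si * (bi * d))) ≡ (- si) * (bi * (sj * (aj * d)))
  exchange = solve 5 (λ sj aj si bi d → (:- sj) :* (aj :* (si :* (bi :* d))) := (:- si) :* (bi :* (sj :* (aj :* d)))) refl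

det-transpose : ∀ {n} (A : Matrix n) → det (λ r c → A c r) ≡ det A
det-transpose {zero}  A = refl
det-transpose {suc n} A =
  trans (det-expand (λ r c → A c r))
    (trans (sum-cong-≗ (λ j → cong (λ x → sgn (toℕ j) * (A j zero * x)) (det-transpose (minor A j zero))))
      (sym (det-expand-column A)))

punchIn-cases : ∀ {n} (i : Fin (suc n)) (k : Fin n) →
  (toℕ k < toℕ i × toℕ (punchIn i k) ≡ toℕ k) ⊎ (toℕ i ≤ toℕ k × toℕ (punchIn i k) ≡ suc (toℕ k))
punchIn-cases zero    k       = inj₂ (z≤n , refl)
punchIn-cases (suc i) zero    = inj₁ (s≤s z≤n , refl)
punchIn-cases (suc i) (suc k) with punchIn-cases i k
... | inj₁ (k<i , e) = inj₁ (s≤s k<i , cong suc e)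
... | inj₂ (i≤k , e) = inj₂ (s≤s i≤k , cong suc e)

punchIn-adjacent : ∀ {n} (a b : Fin (suc n)) → toℕ b ≡ suc (toℕ a) → ∀ k →
  punchIn a k ≡ punchIn b k ⊎ (punchIn a k ≡ b × punchIn b k ≡ a)
punchIn-adjacent a b b≡a+1 k with punchIn-cases a k | punchIn-cases b k
... | inj₁ (_ , ea) | inj₁ (_ , eb) = inj₁ (Fin.toℕ-injective (trans ea (sym eb)))
... | inj₂ (_ , ea) | inj₂ (_ , eb) = inj₁ (Fin.toℕ-injective (trans ea (sym eb)))
... | inj₁ (k<a , _) | inj₂ (b≤k , _) = ⊥-elim (ℕ.<⇒≱ k<a (ℕ.≤-trans (ℕ.n≤1+n _) (subst (_≤ toℕ k) b≡a+1 b≤k)))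
... | inj₂ (a≤k , ea) | inj₁ (k<b , eb) =
  inj₂ (Fin.toℕ-injective (trans ea (trans (cong suc k≡a) (sym b≡a+1))) , Fin.toℕ-injective (trans eb k≡a))
  where
  k≡a : toℕ k ≡ toℕ a
  k≡a = ℕ.≤-antisym (ℕ.≤-pred (subst (toℕ k <_) b≡a+1 k<b)) a≤k

punchIn-adjacent⁻¹ : ∀ {n} (j : Fin (suc n)) (a b : Fin n) →
  toℕ (punchIn j b) ≡ suc (toℕ (punchIn j a)) → toℕ b ≡ suc (toℕ a)
punchIn-adjacent⁻¹ j a b e with punchIn-cases j a | punchIn-cases j b
... | inj₁ (_ , ea) | inj₁ (_ , eb) = trans (sym eb) (trans e (cong suc ea))
... | inj₂ (_ , ea) | inj₂ (_ , eb) = ℕ.suc-injective (trans (sym eb) (trans e (cong suc ea)))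
... | inj₁ (a<j , ea) | inj₂ (j≤b , eb) =
  ⊥-elim (ℕ.<⇒≱ a<j (subst (toℕ j ≤_) (ℕ.suc-injective (trans (sym eb) (trans e (cong suc ea)))) j≤b))
... | inj₂ (j≤a , ea) | inj₁ (b<j , eb) =
  ⊥-elim (ℕ.<⇒≱ b<j (ℕ.≤-trans j≤a (subst (toℕ a ≤_) (sym (trans (sym eb) (trans e (cong suc ea)))) (ℕ.m≤n+m (toℕ a) 2))))

punchIn≢ : ∀ {n} {j c : Fin (suc n)} (j≢c : j ≢ c) (k : Fin n) → k ≢ punchOut j≢c → punchIn j k ≢ c
punchIn≢ {j = j} j≢c k k≢c' eq =
  k≢c' (Fin.punchIn-injective j k (punchOut j≢c) (trans eq (sym (Fin.punchIn-punchOut j≢c))))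

det-linear-column : ∀ {n} (A B D : Matrix n) (c : Fin n) (l : ℚ) →
  (∀ r k → k ≢ c → D r k ≡ A r k) → (∀ r k → k ≢ c → D r k ≡ B r k) →
  (∀ r → D r c ≡ A r c + l * B r c) → det D ≡ det A + l * det B
det-linear-column {suc n} A B D c l D≡A D≡B Dc = begin
  det D                                                    ≡⟨ det-expand D ⟩
  sum (firstRowTerm D)                                     ≡⟨ sum-cong-≗ term ⟩
  sum (λ j → firstRowTerm A j + l * firstRowTerm B j)      ≡⟨ ∑-distrib-+ (firstRowTerm A) (λ j → l * firstRowTerm B j) ⟩
  sum (firstRowTerm A) + sum (λ j → l * firstRowTerm B j)  ≡⟨ cong₂ _+_ (det-expand A) (*-distribˡ-sum l (firstRowTerm B)) ⟨
  det A + l * sum (firstRowTerm B)                         ≡⟨ cong (λ x → det A + l * x) (det-expand B) ⟨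
  det A + l * det B                                        ∎
  where
  open ≡-Reasoning
  split : ∀ s a b x l → s * ((a + l * b) * x) ≡ s * (a * x) + l * (s * (b * x))
  split = solve 5 (λ s a b x l → s :* ((a :+ l :* b) :* x) := s :* (a :* x) :+ l :* (s :* (b :* x))) refl
  split′ : ∀ s a x y l → s * (a * (x + l * y)) ≡ s * (a * x) + l * (s * (a * y))
  split′ = solve 5 (λ s a x y l → s :* (a :* (x :+ l :* y)) := s :* (a :* x) :+ l :* (s :* (a :* y))) refl
  term : ∀ j → firstRowTerm D j ≡ firstRowTerm A j + l * firstRowTerm B j
  term j with j Fin.≟ c
  ... | yes refl = begin
    sgn (toℕ j) * (D zero j * det (minor D zero j))
      ≡⟨ cong₂ (λ x y → sgn (toℕ j) * (x * y)) (Dc zero) (det-cong (λ r k → D≡A (suc r) (punchIn j k) (Fin.punchInᵢ≢i j k))) ⟩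
    sgn (toℕ j) * ((A zero j + l * B zero j) * det (minor A zero j))
      ≡⟨ split (sgn (toℕ j)) (A zero j) (B zero j) (det (minor A zero j)) l ⟩
    firstRowTerm A j + l * (sgn (toℕ j) * (B zero j * det (minor A zero j)))
      ≡⟨ cong (λ x → firstRowTerm A j + l * (sgn (toℕ j) * (B zero j * x))) (det-cong minorA≡minorB) ⟩
    firstRowTerm A j + l * firstRowTerm B j
      ∎
    where
    minorA≡minorB : ∀ r k → minor A zero j r k ≡ minor B zero j r k
    minorA≡minorB r k = trans (sym (D≡A (suc r) (punchIn j k) (Fin.punchInᵢ≢i j k))) (D≡B (suc r) (punchIn j k) (Fin.punchInᵢ≢i j k))
  ... | no j≢c = begin
    sgn (toℕ j) * (D zero j * det (minor D zero j))
      ≡⟨ cong₂ (λ x y → sgn (toℕ j) * (x * y)) (D≡A zero j j≢c) minor-linear ⟩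
    sgn (toℕ j) * (A zero j * (det (minor A zero j) + l * det (minor B zero j)))
      ≡⟨ split′ (sgn (toℕ j)) (A zero j) (det (minor A zero j)) (det (minor B zero j)) l ⟩
    firstRowTerm A j + l * (sgn (toℕ j) * (A zero j * det (minor B zero j)))
      ≡⟨ cong (λ x → firstRowTerm A j + l * (sgn (toℕ j) * (x * det (minor B zero j)))) (trans (sym (D≡A zero j j≢c)) (D≡B zero j j≢c)) ⟩
    firstRowTerm A j + l * firstRowTerm B j
      ∎
    where
    minor-linear : det (minor D zero j) ≡ det (minor A zero j) + l * det (minor B zero j)
    minor-linear = det-linear-column (minor A zero j) (minor B zero j) (minor D zero j) (punchOut j≢c) l
      (λ r k k≢c′ → D≡A (suc r) (punchIn j k) (punchIn≢ j≢c k k≢c′))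
      (λ r k k≢c′ → D≡B (suc r) (punchIn j k) (punchIn≢ j≢c k k≢c′))
      (λ r → subst (λ z → D (suc r) z ≡ A (suc r) z + l * B (suc r) z) (sym (Fin.punchIn-punchOut j≢c)) (Dc (suc r)))

minor-swap-adjacent : ∀ {n} (A A′ : Matrix (suc n)) (a b : Fin (suc n)) → toℕ b ≡ suc (toℕ a) →
  (∀ r → A′ r b ≡ A r a) → (∀ r k → k ≢ a → k ≢ b → A′ r k ≡ A r k) →
  ∀ i r k → minor A′ i a r k ≡ minor A i b r k
minor-swap-adjacent A A′ a b b≡a+1 A′b A′k i r k with punchIn-adjacent a b b≡a+1 k
... | inj₁ eq        = trans (A′k (punchIn i r) (punchIn a k) (Fin.punchInᵢ≢i a k) (Fin.punchInᵢ≢i b k ∘ trans (sym eq)))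
                             (cong (A (punchIn i r)) eq)
... | inj₂ (ea , eb) = trans (cong (A′ (punchIn i r)) ea) (trans (A′b (punchIn i r)) (cong (A (punchIn i r)) (sym eb)))

det-swap-adjacent : ∀ {n} (A A′ : Matrix n) (a b : Fin n) → toℕ b ≡ suc (toℕ a) →
  (∀ r → A′ r a ≡ A r b) → (∀ r → A′ r b ≡ A r a) →
  (∀ r k → k ≢ a → k ≢ b → A′ r k ≡ A r k) → det A′ ≡ - det A
det-swap-adjacent {suc n} A A′ a b b≡a+1 A′a A′b A′k = begin
  det A′                           ≡⟨ det-expand A′ ⟩
  sum (firstRowTerm A′)            ≡⟨ sum-cong-except-adjacent _ _ a b b≡a+1 other pair ⟩
  sum (λ j → - firstRowTerm A j)   ≡⟨ sum-neg (firstRowTerm A) ⟩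
  - sum (firstRowTerm A)           ≡⟨ cong -_ (det-expand A) ⟨
  - det A                          ∎
  where
  open ≡-Reasoning
  A≡A′ : ∀ r k → k ≢ a → k ≢ b → A r k ≡ A′ r k
  A≡A′ r k k≢a k≢b = sym (A′k r k k≢a k≢b)
  exchange : ∀ s x y → s * x + (- s) * y ≡ - (s * y) + - ((- s) * x)
  exchange = solve 3 (λ s x y → s :* x :+ (:- s) :* y := (:- (s :* y)) :+ (:- ((:- s) :* x))) refl
  negate : ∀ s x y → s * (x * - y) ≡ - (s * (x * y))
  negate = solve 3 (λ s x y → s :* (x :* (:- y)) := :- (s :* (x :* y))) refl
  pair : firstRowTerm A′ a + firstRowTerm A′ b ≡ - firstRowTerm A a + - firstRowTerm A b
  pair = begin
    sgn (toℕ a) * (A′ zero a * det (minor A′ zero a)) + sgn (toℕ b) * (A′ zero b * det (minor A′ zero b))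
      ≡⟨ cong₂ (λ x y → sgn (toℕ a) * x + sgn (toℕ b) * y)
               (cong₂ _*_ (A′a zero) (det-cong (minor-swap-adjacent A A′ a b b≡a+1 A′b A′k zero)))
               (cong₂ _*_ (A′b zero) (det-cong λ r k → sym (minor-swap-adjacent A′ A a b b≡a+1 (sym ∘ A′a) A≡A′ zero r k))) ⟩
    sgn (toℕ a) * (A zero b * det (minor A zero b)) + sgn (toℕ b) * (A zero a * det (minor A zero a))
      ≡⟨ cong (λ s → sgn (toℕ a) * (A zero b * det (minor A zero b)) + s * (A zero a * det (minor A zero a))) (cong sgn b≡a+1) ⟩
    sgn (toℕ a) * (A zero b * det (minor A zero b)) + (- sgn (toℕ a)) * (A zero a * det (minor A zero a))
      ≡⟨ exchange (sgn (toℕ a)) (A zero b * det (minor A zero b)) (A zero a * det (minor A zero a)) ⟩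
    - firstRowTerm A a + - ((- sgn (toℕ a)) * (A zero b * det (minor A zero b)))
      ≡⟨ cong (λ s → - firstRowTerm A a + - (s * (A zero b * det (minor A zero b)))) (cong sgn b≡a+1) ⟨
    - firstRowTerm A a + - firstRowTerm A b
      ∎
  other : ∀ j → j ≢ a → j ≢ b → firstRowTerm A′ j ≡ - firstRowTerm A j
  other j j≢a j≢b = begin
    sgn (toℕ j) * (A′ zero j * det (minor A′ zero j))   ≡⟨ cong₂ (λ x y → sgn (toℕ j) * (x * y)) (A′k zero j j≢a j≢b) minor-swapped ⟩
    sgn (toℕ j) * (A zero j * - det (minor A zero j))   ≡⟨ negate (sgn (toℕ j)) (A zero j) (det (minor A zero j)) ⟩
    - firstRowTerm A j                                   ∎
    where
    minor-swapped : det (minor A′ zero j) ≡ - det (minor A zero j)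
    minor-swapped = det-swap-adjacent (minor A zero j) (minor A′ zero j) (punchOut j≢a) (punchOut j≢b)
      (punchIn-adjacent⁻¹ j (punchOut j≢a) (punchOut j≢b)
         (trans (cong toℕ (Fin.punchIn-punchOut j≢b)) (trans b≡a+1 (cong (suc ∘ toℕ) (sym (Fin.punchIn-punchOut j≢a))))))
      (λ r → trans (cong (A′ (suc r)) (Fin.punchIn-punchOut j≢a)) (trans (A′a (suc r)) (cong (A (suc r)) (sym (Fin.punchIn-punchOut j≢b)))))
      (λ r → trans (cong (A′ (suc r)) (Fin.punchIn-punchOut j≢b)) (trans (A′b (suc r)) (cong (A (suc r)) (sym (Fin.punchIn-punchOut j≢a)))))
      (λ r k k≢a′ k≢b′ → A′k (suc r) (punchIn j k) (punchIn≢ j≢a k k≢a′) (punchIn≢ j≢b k k≢b′))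

det-equal-adjacent-columns : ∀ {n} (A : Matrix n) (a b : Fin n) → toℕ b ≡ suc (toℕ a) →
  (∀ r → A r a ≡ A r b) → det A ≡ 0ℚ
det-equal-adjacent-columns A a b b≡a+1 Aa≡Ab = begin
  det A                     ≡⟨ halve (det A) ⟩
  (det A + det A) * ½       ≡⟨ cong (λ x → (det A + x) * ½) (det-swap-adjacent A A a b b≡a+1 Aa≡Ab (sym ∘ Aa≡Ab) (λ _ _ _ _ → refl)) ⟩
  (det A + - det A) * ½     ≡⟨ cancel (det A) ⟩
  0ℚ                        ∎
  where
  open ≡-Reasoning
  halve : ∀ x → x ≡ (x + x) * ½
  halve = solve 1 (λ x → x := (x :+ x) :* con ½) refl
  cancel : ∀ x → (x + - x) * ½ ≡ 0ℚ
  cancel = solve 1 (λ x → (x :+ :- x) :* con ½ := con 0ℚ) refl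

transpose-i : ∀ {n} (i j : Fin n) → transpose i j i ≡ j
transpose-i i j rewrite dec-true (i Fin.≟ i) refl = refl

transpose-j : ∀ {n} (i j : Fin n) → i ≢ j → transpose i j j ≡ i
transpose-j i j i≢j rewrite dec-false (j Fin.≟ i) (i≢j ∘ sym) | dec-true (j Fin.≟ j) refl = refl

transpose-other : ∀ {n} (i j k : Fin n) → k ≢ i → k ≢ j → transpose i j k ≡ k
transpose-other i j k k≢i k≢j rewrite dec-false (k Fin.≟ i) k≢i | dec-false (k Fin.≟ j) k≢j = refl

-- Induction on the distance between the two columns, moving the right one leftwards by adjacent swaps.
det-equal-columns-at-distance : ∀ {n} (A : Matrix n) (g : ℕ) (a b : Fin n) → toℕ b ≡ suc (g ℕ.+ toℕ a) →
  (∀ r → A r a ≡ A r b) → det A ≡ 0ℚ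
det-equal-columns-at-distance A zero    a b       b≡a+1 Aa≡Ab = det-equal-adjacent-columns A a b b≡a+1 Aa≡Ab
det-equal-columns-at-distance A (suc g) a (suc b) b≡a+g+2 Aa≡Ab =
  ℚ.neg-injective (trans (sym (det-swap-adjacent A A′ b′ (suc b) b+1≡b′+1 (λ r → cong (A r) (transpose-i b′ (suc b)))
                                 (λ r → cong (A r) (transpose-j b′ (suc b) b′≢b+1))
                                 (λ r k k≢b′ k≢b+1 → cong (A r) (transpose-other b′ (suc b) k k≢b′ k≢b+1))))
                         (det-equal-columns-at-distance A′ g a b′ b′≡a+g+1 A′a≡A′b′))
  where
  b′ = inject₁ b
  A′ : Matrix _
  A′ r k = A r (transpose b′ (suc b) k)
  b′≡a+g+1 : toℕ b′ ≡ suc (g ℕ.+ toℕ a)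
  b′≡a+g+1 = trans (Fin.toℕ-inject₁ b) (ℕ.suc-injective b≡a+g+2)
  b+1≡b′+1 : toℕ (suc b) ≡ suc (toℕ b′)
  b+1≡b′+1 = cong suc (sym (Fin.toℕ-inject₁ b))
  b′≢b+1 : b′ ≢ suc b
  b′≢b+1 eq = ℕ.<⇒≢ (ℕ.n<1+n (toℕ b′)) (trans (cong toℕ eq) b+1≡b′+1)
  a<b′ : toℕ a < toℕ b′
  a<b′ = subst (toℕ a <_) (sym b′≡a+g+1) (s≤s (ℕ.m≤n+m (toℕ a) g))
  A′a≡A′b′ : ∀ r → A′ r a ≡ A′ r b′
  A′a≡A′b′ r = begin
    A r (transpose b′ (suc b) a)  ≡⟨ cong (A r) (transpose-other b′ (suc b) a (ℕ.<⇒≢ a<b′ ∘ cong toℕ) a≢b+1) ⟩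
    A r a                         ≡⟨ Aa≡Ab r ⟩
    A r (suc b)                   ≡⟨ cong (A r) (transpose-i b′ (suc b)) ⟨
    A r (transpose b′ (suc b) b′) ∎
    where
    open ≡-Reasoning
    a≢b+1 : a ≢ suc b
    a≢b+1 eq = ℕ.<⇒≢ (ℕ.<-trans a<b′ (subst (toℕ b′ <_) (sym b+1≡b′+1) (ℕ.n<1+n _))) (cong toℕ eq)

det-equal-columns-< : ∀ {n} (A : Matrix n) (a b : Fin n) → toℕ a < toℕ b → (∀ r → A r a ≡ A r b) → det A ≡ 0ℚ
det-equal-columns-< A a b a<b =
  det-equal-columns-at-distance A (toℕ b ∸ suc (toℕ a)) a b
    (sym (trans (sym (ℕ.+-suc (toℕ b ∸ suc (toℕ a)) (toℕ a))) (ℕ.m∸n+n≡m a<b)))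

det-equal-columns : ∀ {n} (A : Matrix n) (a b : Fin n) → a ≢ b → (∀ r → A r a ≡ A r b) → det A ≡ 0ℚ
det-equal-columns A a b a≢b Aa≡Ab with ℕ.<-cmp (toℕ a) (toℕ b)
... | tri< a<b _ _ = det-equal-columns-< A a b a<b Aa≡Ab
... | tri≈ _ a≡b _ = ⊥-elim (a≢b (Fin.toℕ-injective a≡b))
... | tri> _ _ b<a = det-equal-columns-< A b a b<a (sym ∘ Aa≡Ab)

replaceColumn : ∀ {n} → Matrix n → Fin n → (Fin n → ℚ) → Matrix n
replaceColumn A c v r = updateAt (A r) c (λ _ → v r)

replaceColumn-at : ∀ {n} (A : Matrix n) c v r → replaceColumn A c v r c ≡ v r
replaceColumn-at A c v r = updateAt-updates c (A r)

replaceColumn-other : ∀ {n} (A : Matrix n) c v r k → k ≢ c → replaceColumn A c v r k ≡ A r k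
replaceColumn-other A c v r k k≢c = updateAt-minimal k c (A r) k≢c

det-linear-replaceColumn : ∀ {n} (A : Matrix n) (c : Fin n) (v w : Fin n → ℚ) (l : ℚ) →
  det (replaceColumn A c (λ r → v r + l * w r)) ≡ det (replaceColumn A c v) + l * det (replaceColumn A c w)
det-linear-replaceColumn A c v w l = det-linear-column _ _ _ c l
  (λ r k k≢c → trans (replaceColumn-other A c u r k k≢c) (sym (replaceColumn-other A c v r k k≢c)))
  (λ r k k≢c → trans (replaceColumn-other A c u r k k≢c) (sym (replaceColumn-other A c w r k k≢c)))
  (λ r → trans (replaceColumn-at A c u r) (sym (cong₂ (λ x y → x + l * y) (replaceColumn-at A c v r) (replaceColumn-at A c w r))))
  where
  u : Fin _ → ℚ
  u r = v r + l * w r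

det-zero-column : ∀ {n} (A : Matrix n) (c : Fin n) → det (replaceColumn A c (λ _ → 0ℚ)) ≡ 0ℚ
det-zero-column A c = begin
  det Z                     ≡⟨ det-linear-replaceColumn A c (λ _ → 0ℚ) (λ _ → 0ℚ) (- 1ℚ) ⟩
  det Z + (- 1ℚ) * det Z    ≡⟨ cancel (det Z) ⟩
  0ℚ                        ∎
  where
  open ≡-Reasoning
  Z = replaceColumn A c (λ _ → 0ℚ)
  cancel : ∀ x → x + (- 1ℚ) * x ≡ 0ℚ
  cancel = solve 1 (λ x → x :+ con (- 1ℚ) :* x := con 0ℚ) refl

det-scale-column : ∀ {n} (A : Matrix n) (c : Fin n) (v : Fin n → ℚ) (l : ℚ) →
  det (replaceColumn A c (λ r → l * v r)) ≡ l * det (replaceColumn A c v)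
det-scale-column A c v l = begin
  det (replaceColumn A c (λ r → l * v r))
    ≡⟨ det-cong (λ r k → cong (λ x → replaceColumn A c (λ _ → x) r k) (sym (ℚ.+-identityˡ (l * v r)))) ⟩
  det (replaceColumn A c (λ r → 0ℚ + l * v r))                  ≡⟨ det-linear-replaceColumn A c (λ _ → 0ℚ) v l ⟩
  det (replaceColumn A c (λ _ → 0ℚ)) + l * det (replaceColumn A c v)  ≡⟨ cong (_+ l * det (replaceColumn A c v)) (det-zero-column A c) ⟩
  0ℚ + l * det (replaceColumn A c v)                            ≡⟨ ℚ.+-identityˡ _ ⟩
  l * det (replaceColumn A c v)                                 ∎
  where open ≡-Reasoning

det-sum-column : ∀ {n p} (A : Matrix n) (c : Fin n) (v : Fin p → Fin n → ℚ) →
  det (replaceColumn A c (λ r → sum (λ q → v q r))) ≡ sum (λ q → det (replaceColumn A c (v q)))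
det-sum-column {p = zero}  A c v = det-zero-column A c
det-sum-column {p = suc p} A c v = begin
  det (replaceColumn A c (λ r → v zero r + rest r))
    ≡⟨ det-cong (λ r k → cong (λ x → replaceColumn A c (λ _ → v zero r + x) r k) (sym (ℚ.*-identityˡ (rest r)))) ⟩
  det (replaceColumn A c (λ r → v zero r + 1ℚ * rest r))
    ≡⟨ det-linear-replaceColumn A c (v zero) rest 1ℚ ⟩
  det (replaceColumn A c (v zero)) + 1ℚ * det (replaceColumn A c rest)
    ≡⟨ cong (det (replaceColumn A c (v zero)) +_) (trans (ℚ.*-identityˡ _) (det-sum-column A c (v ∘ suc))) ⟩
  sum (λ q → det (replaceColumn A c (v q)))
    ∎
  where
  open ≡-Reasoning
  rest : Fin _ → ℚ
  rest r = sum (λ q → v (suc q) r)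

-- Expanding the column of row sums by linearity, every term but the c-th has two equal columns.
det-replaceColumn-rowSum : ∀ {n} (A : Matrix n) (c : Fin n) → det (replaceColumn A c (λ r → sum (A r))) ≡ det A
det-replaceColumn-rowSum A c = begin
  det (replaceColumn A c (λ r → sum (A r)))           ≡⟨ det-sum-column A c (λ k r → A r k) ⟩
  sum (λ k → det (replaceColumn A c (λ r → A r k)))   ≡⟨ sum-single _ c duplicate ⟩
  det (replaceColumn A c (λ r → A r c))               ≡⟨ det-cong unchanged ⟩
  det A                                               ∎
  where
  open ≡-Reasoning
  duplicate : ∀ k → k ≢ c → det (replaceColumn A c (λ r → A r k)) ≡ 0ℚ
  duplicate k k≢c = det-equal-columns _ c k (k≢c ∘ sym)
    (λ r → trans (replaceColumn-at A c (λ r → A r k) r) (sym (replaceColumn-other A c (λ r → A r k) r k k≢c)))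
  unchanged : ∀ r k → replaceColumn A c (λ r → A r c) r k ≡ A r k
  unchanged r k with k Fin.≟ c
  ... | yes refl = replaceColumn-at A k (λ r → A r k) r
  ... | no k≢c   = replaceColumn-other A c (λ r → A r c) r k k≢c

det-add-column : ∀ {n} (A D : Matrix n) (a b : Fin n) → a ≢ b → (∀ r k → k ≢ a → D r k ≡ A r k) →
  (∀ r → D r a ≡ A r a + A r b) → det D ≡ det A
det-add-column A D a b a≢b D≡A Da = begin
  det D                 ≡⟨ det-linear-column A B D a 1ℚ D≡A D≡B Da′ ⟩
  det A + 1ℚ * det B    ≡⟨ cong (λ x → det A + 1ℚ * x) (det-equal-columns B a b a≢b B-equal) ⟩
  det A + 1ℚ * 0ℚ       ≡⟨ ℚ.+-identityʳ (det A) ⟩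
  det A                 ∎
  where
  open ≡-Reasoning
  B = replaceColumn A a (λ r → A r b)
  D≡B : ∀ r k → k ≢ a → D r k ≡ B r k
  D≡B r k k≢a = trans (D≡A r k k≢a) (sym (replaceColumn-other A a (λ r → A r b) r k k≢a))
  Da′ : ∀ r → D r a ≡ A r a + 1ℚ * B r a
  Da′ r = trans (Da r) (cong (A r a +_) (sym (trans (ℚ.*-identityˡ (B r a)) (replaceColumn-at A a (λ r → A r b) r))))
  B-equal : ∀ r → B r a ≡ B r b
  B-equal r = trans (replaceColumn-at A a (λ r → A r b) r) (sym (replaceColumn-other A a (λ r → A r b) r b (a≢b ∘ sym)))

det-add-next-columns : ∀ {n} (K : ℕ) → K < n → (A D : Matrix n) →
  (∀ r c → K ≤ toℕ c → D r c ≡ A r c) →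
  (∀ r c c′ → toℕ c < K → toℕ c′ ≡ suc (toℕ c) → D r c ≡ A r c + A r c′) → det D ≡ det A
det-add-next-columns zero    _     A D D≡A _  = det-cong (λ r c → D≡A r c z≤n)
det-add-next-columns {n} (suc K) K+1<n A D D≡A Dc =
  trans (det-add-column E D cK cK+1 cK≢cK+1 (λ r k k≢cK → sym (replaceColumn-other D cK (λ r → A r cK) r k k≢cK)) DcK)
        (det-add-next-columns K K<n A E E≡A Ec)
  where
  K<n : K < n
  K<n = ℕ.<-trans (ℕ.n<1+n K) K+1<n
  cK cK+1 : Fin n
  cK = Fin.fromℕ< K<n
  cK+1 = Fin.fromℕ< K+1<n
  cK≢cK+1 : cK ≢ cK+1
  cK≢cK+1 eq = ℕ.<⇒≢ (ℕ.n<1+n K) (trans (sym (Fin.toℕ-fromℕ< K<n)) (trans (cong toℕ eq) (Fin.toℕ-fromℕ< K+1<n)))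
  E : Matrix n
  E = replaceColumn D cK (λ r → A r cK)
  E≡A : ∀ r c → K ≤ toℕ c → E r c ≡ A r c
  E≡A r c K≤c with c Fin.≟ cK
  ... | yes refl = replaceColumn-at D c (λ r → A r c) r
  ... | no c≢cK  = trans (replaceColumn-other D cK (λ r → A r cK) r c c≢cK)
                         (D≡A r c (ℕ.≤∧≢⇒< K≤c (λ eq → c≢cK (Fin.toℕ-injective (trans (sym eq) (sym (Fin.toℕ-fromℕ< K<n)))))))
  Ec : ∀ r c c′ → toℕ c < K → toℕ c′ ≡ suc (toℕ c) → E r c ≡ A r c + A r c′
  Ec r c c′ c<K c′≡c+1 =
    trans (replaceColumn-other D cK (λ r → A r cK) r c (λ eq → ℕ.<⇒≢ c<K (trans (cong toℕ eq) (Fin.toℕ-fromℕ< K<n))))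
          (Dc r c c′ (ℕ.<-trans c<K (ℕ.n<1+n K)) c′≡c+1)
  DcK : ∀ r → D r cK ≡ E r cK + E r cK+1
  DcK r = trans (Dc r cK cK+1 (subst (_< suc K) (sym (Fin.toℕ-fromℕ< K<n)) (ℕ.n<1+n K))
                    (trans (Fin.toℕ-fromℕ< K+1<n) (cong suc (sym (Fin.toℕ-fromℕ< K<n)))))
                (cong₂ _+_ (sym (replaceColumn-at D cK (λ r → A r cK) r))
                           (sym (trans (replaceColumn-other D cK (λ r → A r cK) r cK+1 (cK≢cK+1 ∘ sym))
                                       (D≡A r cK+1 (ℕ.≤-reflexive (sym (Fin.toℕ-fromℕ< K+1<n)))))))

two : ℚ
two = 1ℚ + 1ℚ

-- Expanding s times along the first column, whose only nonzero entry is the 2 in row 1, leaves a 2 × 2 determinant.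
det-doubled-subdiagonal : ∀ s (A : Matrix (suc (suc s))) →
  (∀ r c → toℕ c < s → A r c ≡ (if toℕ r ≡ᵇ suc (toℕ c) then two else 0ℚ)) →
  ∀ x y → toℕ x ≡ s → toℕ y ≡ suc s →
  det A ≡ sgn s * fromℕ (2 ^ s) * (A zero x * A y y - A zero y * A y x)
det-doubled-subdiagonal zero A _ zero (suc zero) _ _ = 2×2 (A zero zero) (A zero (suc zero)) (A (suc zero) zero) (A (suc zero) (suc zero))
  where
  -- the left-hand side is det A as computed by the definition of det
  2×2 : ∀ a b c d → 1ℚ * (a * (1ℚ * (d * 1ℚ) + 0ℚ)) + ((- 1ℚ) * (b * (1ℚ * (c * 1ℚ) + 0ℚ)) + 0ℚ)
                  ≡ 1ℚ * 1ℚ * (a * d - b * c)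
  2×2 = solve 4 (λ a b c d → con 1ℚ :* (a :* (con 1ℚ :* (d :* con 1ℚ) :+ con 0ℚ))
                               :+ (con (- 1ℚ) :* (b :* (con 1ℚ :* (c :* con 1ℚ) :+ con 0ℚ)) :+ con 0ℚ)
                               := con 1ℚ :* con 1ℚ :* (a :* d :+ :- (b :* c))) refl
det-doubled-subdiagonal (suc s) A A≡ (suc x) (suc (suc y)) x≡s+1 y≡s+2 = begin
  det A
    ≡⟨ det-expand-column A ⟩
  sum (firstColumnTerm A)
    ≡⟨ sum-single (firstColumnTerm A) (suc zero) only-row-1 ⟩
  (- 1ℚ) * (A (suc zero) zero * det (minor A (suc zero) zero))
    ≡⟨ cong₂ (λ u v → (- 1ℚ) * (u * v)) (A≡ (suc zero) zero (s≤s z≤n))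
             (det-doubled-subdiagonal s (minor A (suc zero) zero) minor≡ x (suc y) (ℕ.suc-injective x≡s+1) (ℕ.suc-injective y≡s+2)) ⟩
  (- 1ℚ) * (two * (sgn s * fromℕ (2 ^ s) * X))
    ≡⟨ double (sgn s) (fromℕ (2 ^ s)) X ⟩
  (- sgn s) * (fromℕ (2 ^ s) + fromℕ (2 ^ s)) * X
    ≡⟨ cong (λ z → (- sgn s) * z * X) (fromℕ-2^ s) ⟨
  sgn (suc s) * fromℕ (2 ^ suc s) * X
    ∎
  where
  open ≡-Reasoning
  X : ℚ
  X = A zero (suc x) * A (suc (suc y)) (suc (suc y)) - A zero (suc (suc y)) * A (suc (suc y)) (suc x)
  double : ∀ σ P X → (- 1ℚ) * (two * (σ * P * X)) ≡ (- σ) * (P + P) * X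
  double = solve 3 (λ σ P X → con (- 1ℚ) :* (con two :* (σ :* P :* X)) := (:- σ) :* (P :+ P) :* X) refl
  minor≡ : ∀ r c → toℕ c < s → minor A (suc zero) zero r c ≡ (if toℕ r ≡ᵇ suc (toℕ c) then two else 0ℚ)
  minor≡ zero    c c<s = A≡ zero (suc c) (s≤s c<s)
  minor≡ (suc r) c c<s = A≡ (suc (suc r)) (suc c) (s≤s c<s)
  vanish : ∀ σ d → σ * (0ℚ * d) ≡ 0ℚ
  vanish = solve 2 (λ σ d → σ :* (con 0ℚ :* d) := con 0ℚ) refl
  only-row-1 : ∀ i → i ≢ suc zero → firstColumnTerm A i ≡ 0ℚ
  only-row-1 zero          _   = trans (cong (λ z → 1ℚ * (z * det (minor A zero zero))) (A≡ zero zero (s≤s z≤n)))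
                                       (vanish 1ℚ (det (minor A zero zero)))
  only-row-1 (suc zero)    i≢1 = ⊥-elim (i≢1 refl)
  only-row-1 (suc (suc i)) _   = trans (cong (λ z → sgn (suc (suc (toℕ i))) * (z * det (minor A (suc (suc i)) zero)))
                                             (A≡ (suc (suc i)) zero (s≤s z≤n)))
                                       (vanish (sgn (suc (suc (toℕ i)))) (det (minor A (suc (suc i)) zero)))

-- Cofactors of matrices with zero row and column sums

punchIn-inject₁-self : ∀ {n} (j : Fin n) → punchIn (inject₁ j) j ≡ suc j
punchIn-inject₁-self zero    = refl
punchIn-inject₁-self (suc j) = cong suc (punchIn-inject₁-self j)

punchIn-suc-self : ∀ {n} (j : Fin n) → punchIn (suc j) j ≡ inject₁ j
punchIn-suc-self zero    = refl
punchIn-suc-self (suc j) = cong suc (punchIn-suc-self j)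

-- With zero row sums, the column surviving in the second minor is minus the sum of the columns of the first.
cofactor-inject₁≡cofactor-suc : ∀ {N} (L : Matrix (suc N)) → (∀ r → sum (L r) ≡ 0ℚ) → ∀ i (j : Fin N) →
  cofactor L i (inject₁ j) ≡ cofactor L i (suc j)
cofactor-inject₁≡cofactor-suc {N} L rowSum i j = begin
  sgn (toℕ i ℕ.+ toℕ (inject₁ j)) * det M          ≡⟨ cong (λ x → sgn (toℕ i ℕ.+ x) * det M) (Fin.toℕ-inject₁ j) ⟩
  sgn (toℕ i ℕ.+ toℕ j) * det M                    ≡⟨ flip-signs (sgn (toℕ i ℕ.+ toℕ j)) (det M) ⟩
  (- sgn (toℕ i ℕ.+ toℕ j)) * ((- 1ℚ) * det M)     ≡⟨ cong₂ _*_ (cong sgn (ℕ.+-suc (toℕ i) (toℕ j))) det-M′ ⟨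
  sgn (toℕ i ℕ.+ suc (toℕ j)) * det M′             ∎
  where
  open ≡-Reasoning
  M = minor L i (inject₁ j)
  M′ = minor L i (suc j)
  flip-signs : ∀ s x → s * x ≡ (- s) * ((- 1ℚ) * x)
  flip-signs = solve 2 (λ s x → s :* x := (:- s) :* (con (- 1ℚ) :* x)) refl
  neg≡-1* : ∀ x → - x ≡ (- 1ℚ) * x
  neg≡-1* = solve 1 (λ x → :- x := con (- 1ℚ) :* x) refl
  negRowSum : Fin N → ℚ
  negRowSum r = (- 1ℚ) * sum (M r)
  surviving : ∀ r → M′ r j ≡ negRowSum r
  surviving r = begin
    L (punchIn i r) (punchIn (suc j) j)  ≡⟨ cong (L (punchIn i r)) (punchIn-suc-self j) ⟩
    L (punchIn i r) (inject₁ j)          ≡⟨ inverseˡ-unique _ _ (trans (sym (sum-remove {i = inject₁ j} (L (punchIn i r))))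
                                                                       (rowSum (punchIn i r))) ⟩
    - sum (M r)                          ≡⟨ neg≡-1* (sum (M r)) ⟩
    negRowSum r                            ∎
  M′≡ : ∀ r k → M′ r k ≡ replaceColumn M j negRowSum r k
  M′≡ r k with k Fin.≟ j | punchIn-adjacent (inject₁ j) (suc j) (cong suc (sym (Fin.toℕ-inject₁ j))) k
  ... | yes refl | _ = trans (surviving r) (sym (replaceColumn-at M k negRowSum r))
  ... | no k≢j | inj₁ eq = trans (cong (L (punchIn i r)) (sym eq)) (sym (replaceColumn-other M j negRowSum r k k≢j))
  ... | no k≢j | inj₂ (eq , _) = ⊥-elim (k≢j (Fin.punchIn-injective (inject₁ j) k j (trans eq (sym (punchIn-inject₁-self j)))))
  det-M′ : det M′ ≡ (- 1ℚ) * det M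
  det-M′ = begin
    det M′                                                ≡⟨ det-cong M′≡ ⟩
    det (replaceColumn M j negRowSum)                       ≡⟨ det-scale-column M j (λ r → sum (M r)) (- 1ℚ) ⟩
    (- 1ℚ) * det (replaceColumn M j (λ r → sum (M r)))    ≡⟨ cong ((- 1ℚ) *_) (det-replaceColumn-rowSum M j) ⟩
    (- 1ℚ) * det M                                        ∎

cofactor-transpose : ∀ {N} (L : Matrix (suc N)) i j → cofactor L i j ≡ cofactor (λ r c → L c r) j i
cofactor-transpose L i j = cong₂ _*_ (cong sgn (ℕ.+-comm (toℕ i) (toℕ j))) (sym (det-transpose (minor L i j)))

cofactors-equal : ∀ {N} (L : Matrix (suc N)) → (∀ r → sum (L r) ≡ 0ℚ) → (∀ c → sum (λ r → L r c) ≡ 0ℚ) →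
  ∀ i j → cofactor L i j ≡ cofactor L zero zero
cofactors-equal L rowSum colSum i j =
  trans (<-weakInduction (λ j → cofactor L i j ≡ cofactor L i zero) refl
           (λ k eq → trans (sym (cofactor-inject₁≡cofactor-suc L rowSum i k)) eq) j)
        (<-weakInduction (λ i → cofactor L i zero ≡ cofactor L zero zero) refl
           (λ k eq → trans (sym (row-step k)) eq) i)
  where
  row-step : ∀ k → cofactor L (inject₁ k) zero ≡ cofactor L (suc k) zero
  row-step k = trans (cofactor-transpose L (inject₁ k) zero)
    (trans (cofactor-inject₁≡cofactor-suc (λ r c → L c r) colSum zero k) (sym (cofactor-transpose L (suc k) zero)))

-- The wheel W_n with n = 2p + 2, p = q + 1

module Wheel (q : ℕ) where

  p m n s : ℕ
  p = suc q
  m = suc (p ℕ.+ p)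
  n = suc m
  s = q ℕ.+ suc q

  -- φ k is the paper's coefficient (-1)^k ((n-1) - 2k)/2, computed without truncated subtraction.
  φ : ℕ → ℚ
  φ d = sgn d * ((fromℕ m - (fromℕ d + fromℕ d)) * ½)

  sgn-m : sgn m ≡ - 1ℚ
  sgn-m = cong -_ (sgn-double p)

  sgn-s : sgn s ≡ - 1ℚ
  sgn-s = trans (cong sgn (ℕ.+-suc q q)) (cong -_ (sgn-double q))

  φ-pair : ∀ d → φ d + φ (suc d) ≡ sgn d
  φ-pair d = pair (sgn d) (fromℕ m) (fromℕ d)
    where
    pair : ∀ σ M D → σ * ((M - (D + D)) * ½) + (- σ) * ((M - ((1ℚ + D) + (1ℚ + D))) * ½) ≡ σ
    pair = solve 3 (λ σ M D → σ :* ((M :+ :- (D :+ D)) :* con ½) :+ (:- σ) :* ((M :+ :- ((con 1ℚ :+ D) :+ (con 1ℚ :+ D))) :* con ½) := σ) refl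

  -- m is odd, so reflecting d to m - d flips the sign of both factors of φ.
  φ-mirror : ∀ d → d ≤ m → φ (m ∸ d) ≡ φ d
  φ-mirror d d≤m = begin
    sgn (m ∸ d) * ((fromℕ m - (fromℕ (m ∸ d) + fromℕ (m ∸ d))) * ½)
      ≡⟨ cong₂ (λ σ x → σ * ((fromℕ m - (x + x)) * ½)) sgn-m∸d (fromℕ-∸ m d d≤m) ⟩
    (- sgn d) * ((fromℕ m - ((fromℕ m - fromℕ d) + (fromℕ m - fromℕ d))) * ½)
      ≡⟨ reflect (sgn d) (fromℕ m) (fromℕ d) ⟩
    φ d
      ∎
    where
    open ≡-Reasoning
    reflect : ∀ σ M D → (- σ) * ((M - ((M - D) + (M - D))) * ½) ≡ σ * ((M - (D + D)) * ½)
    reflect = solve 3 (λ σ M D → (:- σ) :* ((M :+ :- ((M :+ :- D) :+ (M :+ :- D))) :* con ½) := σ :* ((M :+ :- (D :+ D)) :* con ½)) refl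
    sgn-m∸d : sgn (m ∸ d) ≡ - sgn d
    sgn-m∸d = begin
      sgn (m ∸ d)                      ≡⟨ ℚ.*-identityʳ (sgn (m ∸ d)) ⟨
      sgn (m ∸ d) * 1ℚ                 ≡⟨ cong (sgn (m ∸ d) *_) (trans (sym (sgn-+ d d)) (sgn-double d)) ⟨
      sgn (m ∸ d) * (sgn d * sgn d)    ≡⟨ ℚ.*-assoc (sgn (m ∸ d)) (sgn d) (sgn d) ⟨
      sgn (m ∸ d) * sgn d * sgn d      ≡⟨ cong (_* sgn d) (trans (sym (sgn-+ (m ∸ d) d)) (cong sgn (ℕ.m∸n+n≡m d≤m))) ⟩
      sgn m * sgn d                    ≡⟨ cong (_* sgn d) sgn-m ⟩
      (- 1ℚ) * sgn d                   ≡⟨ ℚ.neg-distribˡ-* 1ℚ (sgn d) ⟨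
      - (1ℚ * sgn d)                   ≡⟨ cong -_ (ℚ.*-identityˡ (sgn d)) ⟩
      - sgn d                          ∎

  p<m : p < m
  p<m = s≤s (ℕ.m≤m+n p p)

  m∸small≢small : ∀ a b → a ≤ p → b ≤ p → m ∸ a ≢ b
  m∸small≢small a b a≤p b≤p e =
    ℕ.<⇒≢ (s≤s (ℕ.+-mono-≤ b≤p a≤p)) (trans (cong (ℕ._+ a) (sym e)) (ℕ.m∸n+n≡m (ℕ.≤-trans a≤p (ℕ.<⇒≤ p<m))))

  coefficient≡φ : ∀ u → u ≤ p → sgn u * (half (m ∸ 2 ℕ.* u) * 1ℚ) ≡ φ u
  coefficient≡φ u u≤p = cong (sgn u *_) (begin
    half (m ∸ 2 ℕ.* u) * 1ℚ              ≡⟨ ℚ.*-identityʳ _ ⟩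
    half (m ∸ 2 ℕ.* u)                   ≡⟨ half≡fromℕ*½ (m ∸ 2 ℕ.* u) ⟩
    fromℕ (m ∸ 2 ℕ.* u) * ½              ≡⟨ cong (_* ½) (fromℕ-∸ m (2 ℕ.* u) 2u≤m) ⟩
    (fromℕ m - fromℕ (2 ℕ.* u)) * ½      ≡⟨ cong (λ x → (fromℕ m - x) * ½) fromℕ-2u ⟩
    (fromℕ m - (fromℕ u + fromℕ u)) * ½  ∎)
    where
    open ≡-Reasoning
    2u≤m : 2 ℕ.* u ≤ m
    2u≤m = ℕ.≤-trans (ℕ.+-mono-≤ u≤p (subst (_≤ p) (sym (ℕ.+-identityʳ u)) u≤p)) (ℕ.n≤1+n (p ℕ.+ p))
    fromℕ-2u : fromℕ (2 ℕ.* u) ≡ fromℕ u + fromℕ u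
    fromℕ-2u = trans (fromℕ-+ u (u ℕ.+ 0)) (cong (λ x → fromℕ u + fromℕ x) (ℕ.+-identityʳ u))

  term : Fin m → ℕ → ℚ
  term t k = sgn (suc k) * (half (m ∸ 2 ℕ.* suc k) * cvec n (suc k) t)

  circulant : Fin m → ℚ
  circulant t = sumTo p (term t)

  term-hit : ∀ k t → k < p → toℕ t ≡ suc k ⊎ toℕ t ≡ m ∸ suc k → term t k ≡ φ (suc k)
  term-hit k t k<p hit = trans (cong (λ x → sgn (suc k) * (half (m ∸ 2 ℕ.* suc k) * x)) (indicator hit)) (coefficient≡φ (suc k) k<p)
    where
    indicator : toℕ t ≡ suc k ⊎ toℕ t ≡ m ∸ suc k → cvec n (suc k) t ≡ 1ℚ
    indicator (inj₁ e) = cong (λ b → if b ∨ (suc (toℕ t) ≡ᵇ m ∸ k) then 1ℚ else 0ℚ) (dec-true (toℕ t ℕ.≟ suc k) e)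
    indicator (inj₂ e) = trans (cong (λ b → if (toℕ t ≡ᵇ suc k) ∨ b then 1ℚ else 0ℚ)
                                     (trans (cong (suc (toℕ t) ≡ᵇ_) (∸-suc m k (ℕ.<-trans k<p p<m))) (dec-true (toℕ t ℕ.≟ m ∸ suc k) e)))
                               (cong (if_then 1ℚ else 0ℚ) (∨-zeroʳ (toℕ t ≡ᵇ suc k)))

  term-miss : ∀ k t → k < p → toℕ t ≢ suc k → toℕ t ≢ m ∸ suc k → term t k ≡ 0ℚ
  term-miss k t k<p miss₁ miss₂ = trans (cong (λ x → sgn (suc k) * (half (m ∸ 2 ℕ.* suc k) * x)) indicator)
                                        (vanish (sgn (suc k)) (half (m ∸ 2 ℕ.* suc k)))
    where
    vanish : ∀ σ h → σ * (h * 0ℚ) ≡ 0ℚ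
    vanish = solve 2 (λ σ h → σ :* (h :* con 0ℚ) := con 0ℚ) refl
    indicator : cvec n (suc k) t ≡ 0ℚ
    indicator = cong₂ (λ b b′ → if b ∨ b′ then 1ℚ else 0ℚ) (dec-false (toℕ t ℕ.≟ suc k) miss₁)
                      (trans (cong (suc (toℕ t) ≡ᵇ_) (∸-suc m k (ℕ.<-trans k<p p<m))) (dec-false (toℕ t ℕ.≟ m ∸ suc k) miss₂))

  circulant-zero : ∀ t → toℕ t ≡ 0 → circulant t ≡ 0ℚ
  circulant-zero t t≡0 = sumTo-zero p (λ k k<p →
    term-miss k t k<p (λ e → ℕ.0≢1+n (trans (sym t≡0) e)) (λ e → m∸small≢small (suc k) 0 k<p z≤n (trans (sym e) t≡0)))

  circulant-low : ∀ t k → k < p → toℕ t ≡ suc k → circulant t ≡ φ (suc k)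
  circulant-low t k k<p t≡k+1 = trans (sumTo-single p (term t) k k<p other) (term-hit k t k<p (inj₁ t≡k+1))
    where
    other : ∀ j → j < p → j ≢ k → term t j ≡ 0ℚ
    other j j<p j≢k = term-miss j t j<p (λ e → j≢k (ℕ.suc-injective (trans (sym e) t≡k+1)))
                                        (λ e → m∸small≢small (suc j) (suc k) j<p k<p (trans (sym e) t≡k+1))

  circulant-high : ∀ t k → k < p → toℕ t ≡ m ∸ suc k → circulant t ≡ φ (suc k)
  circulant-high t k k<p t≡m∸[k+1] = trans (sumTo-single p (term t) k k<p other) (term-hit k t k<p (inj₂ t≡m∸[k+1]))
    where
    other : ∀ j → j < p → j ≢ k → term t j ≡ 0ℚ
    other j j<p j≢k = term-miss j t j<p (λ e → m∸small≢small (suc k) (suc j) k<p j<p (trans (sym t≡m∸[k+1]) e))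
      (λ e → j≢k (ℕ.suc-injective (ℕ.∸-cancelˡ-≡ (ℕ.≤-trans j<p (ℕ.<⇒≤ p<m)) (ℕ.≤-trans k<p (ℕ.<⇒≤ p<m))
                                                  (trans (sym e) t≡m∸[k+1]))))

  circulant-positive : ∀ t → 0 < toℕ t → circulant t ≡ φ (toℕ t)
  circulant-positive t 0<t with toℕ t ℕ.≤? p
  ... | yes t≤p = trans (circulant-low t (toℕ t ∸ 1) (subst (_≤ p) t≡d+1 t≤p) t≡d+1) (cong φ (sym t≡d+1))
    where
    t≡d+1 : toℕ t ≡ suc (toℕ t ∸ 1)
    t≡d+1 = ∸-suc (toℕ t) 0 0<t
  ... | no t≰p = begin
    circulant t        ≡⟨ circulant-high t k k<p t≡m∸[k+1] ⟩
    φ (suc k)          ≡⟨ cong φ k+1≡m∸t ⟩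
    φ (m ∸ toℕ t)      ≡⟨ φ-mirror (toℕ t) (ℕ.<⇒≤ (Fin.toℕ<n t)) ⟩
    φ (toℕ t)          ∎
    where
    open ≡-Reasoning
    k = m ∸ suc (toℕ t)
    k+1≡m∸t : suc k ≡ m ∸ toℕ t
    k+1≡m∸t = sym (∸-suc m (toℕ t) (Fin.toℕ<n t))
    t≡m∸[k+1] : toℕ t ≡ m ∸ suc k
    t≡m∸[k+1] = sym (trans (cong (m ∸_) k+1≡m∸t) (ℕ.m∸[m∸n]≡n (ℕ.<⇒≤ (Fin.toℕ<n t))))
    k<p : k < p
    k<p = subst (_≤ p) (sym k+1≡m∸t) (ℕ.≤-trans (ℕ.∸-monoʳ-≤ m (ℕ.≰⇒> t≰p)) (ℕ.≤-reflexive (ℕ.m+n∸m≡n p p)))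

  offset : Fin m → Fin m → Fin m
  offset r c = (toℕ c ℕ.+ m ∸ toℕ r) mod m

  offset-≤ : ∀ r c → toℕ r ≤ toℕ c → toℕ (offset r c) ≡ toℕ c ∸ toℕ r
  offset-≤ r c r≤c = begin
    toℕ (offset r c)                   ≡⟨ Fin.toℕ-fromℕ< _ ⟩
    (toℕ c ℕ.+ m ∸ toℕ r) % m          ≡⟨ cong (_% m) (ℕ.+-∸-comm m r≤c) ⟩
    (toℕ c ∸ toℕ r ℕ.+ m) % m          ≡⟨ [m+n]%n≡m%n (toℕ c ∸ toℕ r) m ⟩
    (toℕ c ∸ toℕ r) % m                ≡⟨ m<n⇒m%n≡m (ℕ.≤-<-trans (ℕ.m∸n≤m (toℕ c) (toℕ r)) (Fin.toℕ<n c)) ⟩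
    toℕ c ∸ toℕ r                      ∎
    where open ≡-Reasoning

  offset-> : ∀ r c → toℕ c < toℕ r → toℕ (offset r c) ≡ m ∸ (toℕ r ∸ toℕ c)
  offset-> r c c<r = begin
    toℕ (offset r c)                                 ≡⟨ Fin.toℕ-fromℕ< _ ⟩
    (toℕ c ℕ.+ m ∸ toℕ r) % m                        ≡⟨ cong (λ x → (toℕ c ℕ.+ m ∸ x) % m) (ℕ.m+[n∸m]≡n (ℕ.<⇒≤ c<r)) ⟨
    (toℕ c ℕ.+ m ∸ (toℕ c ℕ.+ (toℕ r ∸ toℕ c))) % m  ≡⟨ cong (_% m) (ℕ.[m+n]∸[m+o]≡n∸o (toℕ c) m (toℕ r ∸ toℕ c)) ⟩
    (m ∸ (toℕ r ∸ toℕ c)) % m                        ≡⟨ m<n⇒m%n≡m (ℕ.∸-monoʳ-< (ℕ.m<n⇒0<n∸m c<r) r∸c≤m) ⟩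
    m ∸ (toℕ r ∸ toℕ c)                              ∎
    where
    open ≡-Reasoning
    r∸c≤m : toℕ r ∸ toℕ c ≤ m
    r∸c≤m = ℕ.≤-trans (ℕ.m∸n≤m (toℕ r) (toℕ c)) (ℕ.<⇒≤ (Fin.toℕ<n r))

  n/2∸1≡p : n ℕ./ 2 ∸ 1 ≡ p
  n/2∸1≡p = cong (_∸ 1) (trans (cong (ℕ._/ 2) n≡p*2+2) (m*n/n≡m (suc p) 2))
    where
    n≡p*2+2 : n ≡ suc p ℕ.* 2
    n≡p*2+2 = cong (λ x → suc (suc x)) (sym (trans (ℕ.*-comm p 2) (cong (p ℕ.+_) (ℕ.+-identityʳ p))))

  laplacian-inner : ∀ r c → specialLaplacian n (suc r) (suc c) ≡
    (if toℕ r ≡ᵇ toℕ c then half m else 0ℚ) + (0ℚ + circulant (offset r c))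
  laplacian-inner r c = cong (λ x → (if toℕ r ≡ᵇ toℕ c then half m else 0ℚ) + (0ℚ + x)) (begin
    sumℚ (List.map F (List.map suc (List.upTo (n ℕ./ 2 ∸ 1))))  ≡⟨ cong (λ P → sumℚ (List.map F (List.map suc (List.upTo P)))) n/2∸1≡p ⟩
    sumℚ (List.map F (List.map suc (List.upTo p)))               ≡⟨ cong sumℚ (List.map-∘ {g = F} {f = suc} (List.upTo p)) ⟨
    sumℚ (List.map (F ∘ suc) (List.upTo p))                      ≡⟨ sumℚ-applyUpTo (F ∘ suc) (λ k → k) p ⟩
    circulant (offset r c)                                       ∎)
    where
    open ≡-Reasoning
    F : ℕ → ℚ
    F k = sgn k * (half (m ∸ 2 ℕ.* k) * C n k r c)

  off-diagonal : ∀ {r c} → toℕ r ≢ toℕ c → circulant (offset r c) ≡ φ ∣ toℕ r - toℕ c ∣ →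
    specialLaplacian n (suc r) (suc c) ≡ φ ∣ toℕ r - toℕ c ∣
  off-diagonal {r} {c} r≢c circulant≡ = trans (laplacian-inner r c)
    (trans (cong₂ (λ b x → (if b then half m else 0ℚ) + (0ℚ + x)) (dec-false (toℕ r ℕ.≟ toℕ c) r≢c) circulant≡)
           (trans (ℚ.+-identityˡ _) (ℚ.+-identityˡ _)))

  entry : ∀ r c → specialLaplacian n (suc r) (suc c) ≡ φ ∣ toℕ r - toℕ c ∣
  entry r c with ℕ.<-cmp (toℕ r) (toℕ c)
  ... | tri≈ _ r≡c _ = begin
    specialLaplacian n (suc r) (suc c)                       ≡⟨ laplacian-inner r c ⟩
    (if toℕ r ≡ᵇ toℕ c then half m else 0ℚ) + (0ℚ + circulant (offset r c))
      ≡⟨ cong₂ (λ b x → (if b then half m else 0ℚ) + (0ℚ + x)) (dec-true (toℕ r ℕ.≟ toℕ c) r≡c)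
               (circulant-zero (offset r c) (trans (offset-≤ r c (ℕ.≤-reflexive r≡c)) (trans (cong (toℕ c ∸_) r≡c) (ℕ.n∸n≡0 (toℕ c))))) ⟩
    half m + (0ℚ + 0ℚ)                                       ≡⟨ cong (_+ (0ℚ + 0ℚ)) (half≡fromℕ*½ m) ⟩
    fromℕ m * ½ + (0ℚ + 0ℚ)                                  ≡⟨ diagonal (fromℕ m) ⟩
    φ 0                                                      ≡⟨ cong φ (ℕ.m≡n⇒∣m-n∣≡0 r≡c) ⟨
    φ ∣ toℕ r - toℕ c ∣                                      ∎
    where
    open ≡-Reasoning
    diagonal : ∀ M → M * ½ + (0ℚ + 0ℚ) ≡ 1ℚ * ((M - (0ℚ + 0ℚ)) * ½)
    diagonal = solve 1 (λ M → M :* con ½ :+ (con 0ℚ :+ con 0ℚ) := con 1ℚ :* ((M :+ :- (con 0ℚ :+ con 0ℚ)) :* con ½)) refl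
  ... | tri< r<c _ _ = off-diagonal (ℕ.<⇒≢ r<c) (begin
    circulant (offset r c)   ≡⟨ circulant-positive (offset r c) (subst (0 <_) (sym (offset-≤ r c (ℕ.<⇒≤ r<c))) (ℕ.m<n⇒0<n∸m r<c)) ⟩
    φ (toℕ (offset r c))     ≡⟨ cong φ (offset-≤ r c (ℕ.<⇒≤ r<c)) ⟩
    φ (toℕ c ∸ toℕ r)        ≡⟨ cong φ (ℕ.m≤n⇒∣m-n∣≡n∸m (ℕ.<⇒≤ r<c)) ⟨
    φ ∣ toℕ r - toℕ c ∣      ∎)
    where open ≡-Reasoning
  ... | tri> _ _ c<r = off-diagonal (ℕ.<⇒≢ c<r ∘ sym) (begin
    circulant (offset r c)      ≡⟨ circulant-positive (offset r c) (subst (0 <_) (sym (offset-> r c c<r)) (ℕ.m<n⇒0<n∸m r∸c<m)) ⟩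
    φ (toℕ (offset r c))        ≡⟨ cong φ (offset-> r c c<r) ⟩
    φ (m ∸ (toℕ r ∸ toℕ c))     ≡⟨ φ-mirror (toℕ r ∸ toℕ c) (ℕ.<⇒≤ r∸c<m) ⟩
    φ (toℕ r ∸ toℕ c)           ≡⟨ cong φ (ℕ.m≤n⇒∣n-m∣≡n∸m (ℕ.<⇒≤ c<r)) ⟨
    φ ∣ toℕ r - toℕ c ∣         ∎)
    where
    open ≡-Reasoning
    r∸c<m : toℕ r ∸ toℕ c < m
    r∸c<m = ℕ.≤-<-trans (ℕ.m∸n≤m (toℕ r) (toℕ c)) (Fin.toℕ<n r)

  sumTo-φ-even : ∀ k → sumTo (k ℕ.+ k) φ ≡ fromℕ k
  sumTo-φ-even zero    = refl
  sumTo-φ-even (suc k) = begin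
    sumTo (suc (k ℕ.+ suc k)) φ                              ≡⟨ cong (λ z → sumTo (suc z) φ) (ℕ.+-suc k k) ⟩
    sumTo (suc (suc (k ℕ.+ k))) φ                            ≡⟨ sumTo-snoc (suc (k ℕ.+ k)) φ ⟩
    sumTo (suc (k ℕ.+ k)) φ + φ (suc (k ℕ.+ k))              ≡⟨ cong (_+ φ (suc (k ℕ.+ k))) (sumTo-snoc (k ℕ.+ k) φ) ⟩
    sumTo (k ℕ.+ k) φ + φ (k ℕ.+ k) + φ (suc (k ℕ.+ k))      ≡⟨ ℚ.+-assoc (sumTo (k ℕ.+ k) φ) _ _ ⟩
    sumTo (k ℕ.+ k) φ + (φ (k ℕ.+ k) + φ (suc (k ℕ.+ k)))    ≡⟨ cong₂ _+_ (sumTo-φ-even k) (trans (φ-pair (k ℕ.+ k)) (sgn-double k)) ⟩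
    fromℕ k + 1ℚ                                             ≡⟨ ℚ.+-comm (fromℕ k) 1ℚ ⟩
    1ℚ + fromℕ k                                             ∎
    where open ≡-Reasoning

  sumTo-φ : sumTo m φ ≡ ½
  sumTo-φ = begin
    sumTo m φ
      ≡⟨ sumTo-snoc (p ℕ.+ p) φ ⟩
    sumTo (p ℕ.+ p) φ + φ (p ℕ.+ p)
      ≡⟨ cong₂ _+_ (sumTo-φ-even p) (cong₂ (λ σ x → σ * ((1ℚ + x - (x + x)) * ½)) (sgn-double p) (fromℕ-+ p p)) ⟩
    fromℕ p + 1ℚ * ((1ℚ + (fromℕ p + fromℕ p) - ((fromℕ p + fromℕ p) + (fromℕ p + fromℕ p))) * ½)
      ≡⟨ simplify (fromℕ p) ⟩
    ½ ∎
    where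
    open ≡-Reasoning
    simplify : ∀ P → P + 1ℚ * ((1ℚ + (P + P) - ((P + P) + (P + P))) * ½) ≡ ½
    simplify = solve 1 (λ P → P :+ con 1ℚ :* ((con 1ℚ :+ (P :+ P) :+ :- ((P :+ P) :+ (P :+ P))) :* con ½) := con ½) refl

  -- Row r + 1 of Φ is row r shifted right by one: the entry φ (r + 1) leaves at the end and enters at the front.
  row-sum : ∀ r → r < m → sumTo m (λ c → φ ∣ r - c ∣) ≡ ½
  row-sum zero    _     = sumTo-φ
  row-sum (suc r) r+1<m = begin
    φ (suc r) + sumTo (p ℕ.+ p) (λ c → φ ∣ r - c ∣)    ≡⟨ ℚ.+-comm (φ (suc r)) _ ⟩
    sumTo (p ℕ.+ p) (λ c → φ ∣ r - c ∣) + φ (suc r)    ≡⟨ cong (sumTo (p ℕ.+ p) (λ c → φ ∣ r - c ∣) +_) last≡ ⟨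
    sumTo (p ℕ.+ p) (λ c → φ ∣ r - c ∣) + φ ∣ r - p ℕ.+ p ∣  ≡⟨ sumTo-snoc (p ℕ.+ p) (λ c → φ ∣ r - c ∣) ⟨
    sumTo m (λ c → φ ∣ r - c ∣)                        ≡⟨ row-sum r (ℕ.<-trans (ℕ.n<1+n r) r+1<m) ⟩
    ½                                                  ∎
    where
    open ≡-Reasoning
    last≡ : φ ∣ r - p ℕ.+ p ∣ ≡ φ (suc r)
    last≡ = trans (cong φ (ℕ.m≤n⇒∣m-n∣≡n∸m (ℕ.<⇒≤ (ℕ.≤-pred r+1<m)))) (φ-mirror (suc r) (ℕ.<⇒≤ r+1<m))

  L̃ : Matrix n
  L̃ = specialLaplacian n

  border-sum : half m + (0ℚ + 0ℚ) + sum {m} (λ _ → 0ℚ + (- half 1 + 0ℚ)) ≡ 0ℚ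
  border-sum = begin
    half m + (0ℚ + 0ℚ) + sum {m} (λ _ → 0ℚ + (- ½ + 0ℚ))
      ≡⟨ cong₂ (λ x y → x + (0ℚ + 0ℚ) + y) (half≡fromℕ*½ m) (sum-const m (0ℚ + (- ½ + 0ℚ))) ⟩
    fromℕ m * ½ + (0ℚ + 0ℚ) + fromℕ m * (0ℚ + (- ½ + 0ℚ))    ≡⟨ cancel (fromℕ m) ⟩
    0ℚ                                                        ∎
    where
    open ≡-Reasoning
    cancel : ∀ M → M * ½ + (0ℚ + 0ℚ) + M * (0ℚ + (- ½ + 0ℚ)) ≡ 0ℚ
    cancel = solve 1 (λ M → M :* con ½ :+ (con 0ℚ :+ con 0ℚ) :+ M :* (con 0ℚ :+ (:- con ½ :+ con 0ℚ)) := con 0ℚ) refl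

  L̃-rowSum : ∀ r → sum (L̃ r) ≡ 0ℚ
  L̃-rowSum zero    = border-sum
  L̃-rowSum (suc r) = cong (0ℚ + (- half 1 + 0ℚ) +_) (trans (sum-cong-≗ (entry r)) (row-sum (toℕ r) (Fin.toℕ<n r)))

  L̃-columnSum : ∀ c → sum (λ r → L̃ r c) ≡ 0ℚ
  L̃-columnSum zero    = border-sum
  L̃-columnSum (suc c) = cong (0ℚ + (- half 1 + 0ℚ) +_)
    (trans (sum-cong-≗ (λ r → trans (entry r c) (cong φ (ℕ.∣-∣-comm (toℕ r) (toℕ c))))) (row-sum (toℕ c) (Fin.toℕ<n c)))

  Φ : Matrix m
  Φ r c = φ ∣ toℕ r - toℕ c ∣

  alternating : ℕ → ℕ → ℚ
  alternating r c = sgn ((c ∸ r) ℕ.+ (r ∸ suc c))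

  φ-adjacent : ∀ r c → φ ∣ r - c ∣ + φ ∣ r - suc c ∣ ≡ alternating r c
  φ-adjacent zero    c       = trans (φ-pair c) (cong sgn (sym (ℕ.+-identityʳ c)))
  φ-adjacent (suc r) zero    = trans (cong (λ x → φ (suc r) + φ x) (ℕ.∣-∣-identityʳ r)) (trans (ℚ.+-comm (φ (suc r)) (φ r)) (φ-pair r))
  φ-adjacent (suc r) (suc c) = φ-adjacent r c

  alternating-adjacent : ∀ r c → alternating r c + alternating r (suc c) ≡ (if r ≡ᵇ suc c then two else 0ℚ)
  alternating-adjacent zero          c       = ℚ.+-inverseʳ (sgn (c ℕ.+ 0))
  alternating-adjacent (suc zero)    zero    = refl
  alternating-adjacent (suc (suc r)) zero    = ℚ.+-inverseˡ (sgn r)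
  alternating-adjacent (suc r)       (suc c) = alternating-adjacent r c

  -- Φ after adding to each of its first 2p columns the next one.
  Φ₁ : Matrix m
  Φ₁ r c = if does (toℕ c ℕ.<? p ℕ.+ p) then alternating (toℕ r) (toℕ c) else Φ r c

  -- Φ₁ after adding to each of its first s columns the next one.
  Φ₂ : Matrix m
  Φ₂ r c = if does (toℕ c ℕ.<? s) then (if toℕ r ≡ᵇ suc (toℕ c) then two else 0ℚ) else Φ₁ r c

  det-Φ₁ : det Φ₁ ≡ det Φ
  det-Φ₁ = det-add-next-columns (p ℕ.+ p) (ℕ.n<1+n (p ℕ.+ p)) Φ Φ₁
    (λ r c 2p≤c → if-no (toℕ c ℕ.<? p ℕ.+ p) _ (Φ r c) (ℕ.≤⇒≯ 2p≤c))
    (λ r c c′ c<2p c′≡c+1 → trans (if-yes (toℕ c ℕ.<? p ℕ.+ p) _ (Φ r c) c<2p)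
                                  (trans (sym (φ-adjacent (toℕ r) (toℕ c))) (cong (λ z → Φ r c + φ ∣ toℕ r - z ∣) (sym c′≡c+1))))

  det-Φ₂ : det Φ₂ ≡ det Φ₁
  det-Φ₂ = det-add-next-columns s (ℕ.<-trans (ℕ.n<1+n s) (ℕ.n<1+n (suc s))) Φ₁ Φ₂
    (λ r c s≤c → if-no (toℕ c ℕ.<? s) _ (Φ₁ r c) (ℕ.≤⇒≯ s≤c))
    (λ r c c′ c<s c′≡c+1 → trans (if-yes (toℕ c ℕ.<? s) _ (Φ₁ r c) c<s)
       (trans (sym (alternating-adjacent (toℕ r) (toℕ c)))
              (cong₂ _+_ (sym (if-yes (toℕ c ℕ.<? p ℕ.+ p) _ (Φ r c) (ℕ.<-trans c<s (ℕ.n<1+n s))))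
                         (sym (trans (if-yes (toℕ c′ ℕ.<? p ℕ.+ p) _ (Φ r c′) (subst (_< suc s) (sym c′≡c+1) (s≤s c<s)))
                                     (cong (alternating (toℕ r)) c′≡c+1))))))

  x y : Fin m
  x = inject₁ (Fin.fromℕ s)
  y = Fin.fromℕ (suc s)

  x≡s : toℕ x ≡ s
  x≡s = trans (Fin.toℕ-inject₁ (Fin.fromℕ s)) (Fin.toℕ-fromℕ s)

  y≡s+1 : toℕ y ≡ suc s
  y≡s+1 = Fin.toℕ-fromℕ (suc s)

  x≮s : ¬ (toℕ x < s)
  x≮s = ℕ.<-irrefl x≡s

  y≮2p : ¬ (toℕ y < p ℕ.+ p)
  y≮2p = ℕ.<-irrefl y≡s+1

  y≮s : ¬ (toℕ y < s)
  y≮s = y≮2p ∘ (λ y<s → ℕ.<-trans y<s (ℕ.n<1+n s))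

  x<2p : toℕ x < p ℕ.+ p
  x<2p = subst (_< p ℕ.+ p) (sym x≡s) (ℕ.n<1+n s)

  Φ₂-0x : Φ₂ zero x ≡ - 1ℚ
  Φ₂-0x = trans (if-no (toℕ x ℕ.<? s) _ _ x≮s) (trans (if-yes (toℕ x ℕ.<? p ℕ.+ p) _ _ x<2p)
            (trans (cong (λ z → sgn (z ℕ.+ 0)) x≡s) (trans (cong sgn (ℕ.+-identityʳ s)) sgn-s)))

  Φ₂-yy : Φ₂ y y ≡ φ 0
  Φ₂-yy = trans (if-no (toℕ y ℕ.<? s) _ _ y≮s) (trans (if-no (toℕ y ℕ.<? p ℕ.+ p) _ _ y≮2p) (cong φ (ℕ.∣n-n∣≡0 (toℕ y))))

  Φ₂-0y : Φ₂ zero y ≡ φ (suc s)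
  Φ₂-0y = trans (if-no (toℕ y ℕ.<? s) _ _ y≮s) (trans (if-no (toℕ y ℕ.<? p ℕ.+ p) _ _ y≮2p) (cong φ y≡s+1))

  Φ₂-yx : Φ₂ y x ≡ 1ℚ
  Φ₂-yx = trans (if-no (toℕ x ℕ.<? s) _ _ x≮s) (trans (if-yes (toℕ x ℕ.<? p ℕ.+ p) _ _ x<2p)
            (trans (cong₂ alternating y≡s+1 x≡s) (cong sgn (cong₂ ℕ._+_ (ℕ.m≤n⇒m∸n≡0 (ℕ.n≤1+n s)) (ℕ.n∸n≡0 s)))))

  det-Φ : det Φ ≡ fromℕ (2 ^ s)
  det-Φ = begin
    det Φ
      ≡⟨ trans det-Φ₂ det-Φ₁ ⟨
    det Φ₂
      ≡⟨ det-doubled-subdiagonal s Φ₂ (λ r c c<s → if-yes (toℕ c ℕ.<? s) _ (Φ₁ r c) c<s) x y x≡s y≡s+1 ⟩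
    sgn s * fromℕ (2 ^ s) * (Φ₂ zero x * Φ₂ y y - Φ₂ zero y * Φ₂ y x)
      ≡⟨ cong₂ (λ σ z → σ * fromℕ (2 ^ s) * z) sgn-s (cong₂ _-_ (cong₂ _*_ Φ₂-0x Φ₂-yy) (cong₂ _*_ Φ₂-0y Φ₂-yx)) ⟩
    (- 1ℚ) * fromℕ (2 ^ s) * ((- 1ℚ) * φ 0 - φ (suc s) * 1ℚ)
      ≡⟨ cong (λ σ → (- 1ℚ) * fromℕ (2 ^ s) * ((- 1ℚ) * φ 0 - σ * ((fromℕ m - (fromℕ (suc s) + fromℕ (suc s))) * ½) * 1ℚ))
              (cong -_ sgn-s) ⟩
    (- 1ℚ) * fromℕ (2 ^ s) * ((- 1ℚ) * φ 0 - (- (- 1ℚ)) * ((fromℕ m - (fromℕ (suc s) + fromℕ (suc s))) * ½) * 1ℚ)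
      ≡⟨ evaluate (fromℕ (2 ^ s)) (fromℕ s) ⟩
    fromℕ (2 ^ s)
      ∎
    where
    open ≡-Reasoning
    evaluate : ∀ P S → (- 1ℚ) * P * ((- 1ℚ) * (1ℚ * ((1ℚ + (1ℚ + S) - (0ℚ + 0ℚ)) * ½))
                         - (- (- 1ℚ)) * ((1ℚ + (1ℚ + S) - ((1ℚ + S) + (1ℚ + S))) * ½) * 1ℚ) ≡ P
    evaluate = solve 2 (λ P S → con (- 1ℚ) :* P :* (con (- 1ℚ) :* (con 1ℚ :* ((con 1ℚ :+ (con 1ℚ :+ S) :+ :- (con 0ℚ :+ con 0ℚ)) :* con ½))
                    :+ :- ((:- con (- 1ℚ)) :* ((con 1ℚ :+ (con 1ℚ :+ S) :+ :- ((con 1ℚ :+ S) :+ (con 1ℚ :+ S))) :* con ½) :* con 1ℚ)) := P) refl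

  cofactor-L̃ : ∀ i j → cofactor L̃ i j ≡ (ℤ.+ (2 ^ (n ∸ 3))) / 1
  cofactor-L̃ i j = begin
    cofactor L̃ i j                   ≡⟨ cofactors-equal L̃ L̃-rowSum L̃-columnSum i j ⟩
    1ℚ * det (minor L̃ zero zero)     ≡⟨ ℚ.*-identityˡ _ ⟩
    det (minor L̃ zero zero)          ≡⟨ det-cong entry ⟩
    det Φ                            ≡⟨ det-Φ ⟩
    fromℕ (2 ^ s)                    ≡⟨ /1≡fromℕ (2 ^ s) ⟨
    (ℤ.+ (2 ^ s)) / 1                ∎
    where open ≡-Reasoning

wheel-parameter : ∀ {n} → 4 ≤ n → 2 ∣ n → ∃[ q ] n ≡ Wheel.n q
wheel-parameter {n} 4≤n (divides zero          n≡0)   = ⊥-elim (ℕ.<⇒≱ (subst (3 <_) n≡0 4≤n) z≤n)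
wheel-parameter {n} 4≤n (divides (suc zero)    n≡2)   = ⊥-elim (ℕ.<⇒≱ (subst (3 <_) n≡2 4≤n) (s≤s (s≤s z≤n)))
wheel-parameter {n} 4≤n (divides (suc (suc q)) n≡2q+4) = q , trans n≡2q+4 (twice q)
  where
  twice : ∀ q → suc (suc q) ℕ.* 2 ≡ 3 ℕ.+ (q ℕ.+ suc q)
  twice = ℕ-solve-∀

open import Data.Integer using (+_)

theorem4 : (n : ℕ) → 4 ≤ n → 2 ∣ n → (i j : Fin n) →
    cofactor (specialLaplacian n) i j ≡ (+ (2 ^ (n ∸ 3))) / 1
theorem4 n 4≤n 2∣n i j with wheel-parameter 4≤n 2∣n
... | q , refl = Wheel.cofactor-L̃ q i j
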